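{- Let $L$ be a nonnegative integer and let $q,z,c$ be indeterminates. Then \[ \sum_{n=-L}^{L}\sum_{m=-L}^{n}(-1)^{n+m}z^{m}q^{T_n}\frac{(cq;q)_{L-m}}{(cq;q)_{L-n}(cq;q)_{n-m}} =\sum_{i,j,k\ge 0}(-1)^k z^{i-j}q^{T_i+T_j+T_k}\frac{1-c}{1-cq^{j}}\begin{bmatrix}L-i\\ j\end{bmatrix}\begin{bmatrix}L-j\\ k\end{bmatrix}\begin{bmatrix}L-k\\ i\end{bmatrix}. \]
   Context: For an integer $n$, $T_n=n(n+1)/2$. For a nonnegative integer $n$, $(a;q)_n=\prod_{k=0}^{n-1}(1-aq^k)$, and $(a_1,\dots,a_r;q)_n=(a_1;q)_n\cdots(a_r;q)_n$. For integers $n,k$, the $q$-binomial coefficient is $\begin{bmatrix}n\\ k\end{bmatrix}=\frac{(q;q)_n}{(q;q)_k(q;q)_{n-k}}$ if $0\le k\le n$ and $0$ otherwise. The identity is an identity of rational functions in $q,z,c$ (Laurent polynomial in $z$). -}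

module Defs where

open import Data.Nat as ℕ using (ℕ; zero; suc)
open import Data.Integer as ℤ using (ℤ; +_; -[1+_])
open import Data.Rational as ℚ using (ℚ; 0ℚ; 1ℚ; _+_; _*_; _-_; -_; 1/_; ≢-nonZero)
open import Relation.Nullary using (yes; no)

-- Total inverse on ℚ (junk value 0 at 0); only used at arguments that the
-- hypotheses of the theorem force to be nonzero.
inv : ℚ → ℚ
inv p with p ℚ.≟ 0ℚ
... | yes _ = 0ℚ
... | no p≢0 = 1/_ p {{≢-nonZero p≢0}}

_^_ : ℚ → ℕ → ℚ
x ^ zero = 1ℚ
x ^ suc n = x * (x ^ n)

_^ℤ_ : ℚ → ℤ → ℚ
x ^ℤ (+ n) = x ^ n
x ^ℤ -[1+ n ] = inv x ^ suc n

T : ℤ → ℤ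
T n = (n ℤ.* (n ℤ.+ ℤ.+ 1)) ℤ./ ℤ.+ 2

poch : ℚ → ℚ → ℕ → ℚ
poch a q zero = 1ℚ
poch a q (suc n) = poch a q n * (1ℚ - a * (q ^ n))

-- (a;q)_n at an integer index; only ever evaluated at nonnegative indices
-- in the theorem (value at negative indices is irrelevant junk 1).
pochℤ : ℚ → ℚ → ℤ → ℚ
pochℤ a q (+ n) = poch a q n
pochℤ a q -[1+ n ] = 1ℚ

qbinom : ℚ → ℤ → ℤ → ℚ
qbinom q n k with ℤ.0ℤ ℤ.≤? k | k ℤ.≤? n
... | yes _ | yes _ = pochℤ q q n * inv (pochℤ q q k * pochℤ q q (n ℤ.- k))
... | _ | _ = 0ℚ

sumFrom : ℤ → ℕ → (ℤ → ℚ) → ℚ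
sumFrom a zero f = 0ℚ
sumFrom a (suc len) f = f a + sumFrom (a ℤ.+ ℤ.+ 1) len f

Σ[_⋯_] : ℤ → ℤ → (ℤ → ℚ) → ℚ
Σ[ a ⋯ b ] f with a ℤ.≤? b
... | yes _ = sumFrom a ℤ.∣ b ℤ.- a ℤ.+ ℤ.+ 1 ∣ f
... | no _ = 0ℚ

Σℕ[0⋯_] : ℕ → (ℕ → ℚ) → ℚ
Σℕ[0⋯ zero ] f = f zero
Σℕ[0⋯ suc b ] f = Σℕ[0⋯ b ] f + f (suc b)

lhs : ℕ → ℚ → ℚ → ℚ → ℚ
lhs L q z c =
  Σ[ ℤ.- (+ L) ⋯ + L ] λ n →
  Σ[ ℤ.- (+ L) ⋯ n ] λ m →
    ((- 1ℚ) ^ℤ (n ℤ.+ m)) * (z ^ℤ m) * (q ^ℤ T n)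
    * pochℤ (c * q) q (+ L ℤ.- m)
    * inv (pochℤ (c * q) q (+ L ℤ.- n) * pochℤ (c * q) q (n ℤ.- m))

-- RHS of the identity.  The sum over i,j,k ≥ 0 is finite: the q-binomials
-- [L-i, j], [L-j, k], [L-k, i] vanish unless i,j,k ≤ L, so it is the sum over
-- 0 ≤ i,j,k ≤ L.
rhs : ℕ → ℚ → ℚ → ℚ → ℚ
rhs L q z c =
  Σℕ[0⋯ L ] λ i → Σℕ[0⋯ L ] λ j → Σℕ[0⋯ L ] λ k →
    ((- 1ℚ) ^ k) * (z ^ℤ (+ i ℤ.- + j))
    * (q ^ℤ (T (+ i) ℤ.+ T (+ j) ℤ.+ T (+ k)))
    * ((1ℚ - c) * inv (1ℚ - c * (q ^ j)))
    * qbinom q (+ L ℤ.- + i) (+ j)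
    * qbinom q (+ L ℤ.- + j) (+ k)
    * qbinom q (+ L ℤ.- + k) (+ i)

{-# OPTIONS --safe #-}
-- The quotient (cq;q)_(a+b) / ((cq;q)_a (cq;q)_b) equals Σ_j (-1)^j q^T(j) (1-c)/(1-cq^j) [a,j] [a+b-j,a]:
-- after multiplying by 1 - cq^(b+1) resp. 1 - cq^(a+b+1), the induction step in b reduces to an alternating
-- q-binomial sum that vanishes. Inserting this with a = L-n, b = n-m and summing over n first, the trinomial
-- revision [S-t,j] [S-j,S-t] = [S-j,j] [S-2j,t-j] (S = L-m, t = n-m) leaves Rothe's identity
-- Σ_r (-1)^r q^T(i+r) [K,r] = q^T(i) (q^(i+1);q)_K with i = m+j, which vanishes for -K ≤ i < 0. So the left
-- side is Σ_(i,j) z^(i-j) q^(T(i)+T(j)) (1-c)/(1-cq^j) [L-i,j] (q^(i+1);q)_(L-i-j). On the right side the sum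
-- over k is Σ_k (-1)^k q^T(k) [L-j,k] [L-k,i] = (q^(i+1);q)_(L-i-j), giving the same double sum.
module Submission where

open import Defs
open import Data.Nat using (ℕ; zero; suc; _≤_; _<_; z≤n; s≤s; _∸_) renaming (_+_ to _+ℕ_; _*_ to _*ℕ_)
import Data.Nat.Properties as ℕP
import Data.Nat.DivMod as ℕD
import Data.Nat.Tactic.RingSolver as ℕSolver
open import Data.Integer as ℤ using (ℤ; +_; -[1+_])
import Data.Integer.Properties as ℤP
import Data.Integer.DivMod as ℤD
import Data.Integer.Tactic.RingSolver as ℤSolver
open import Data.Rational using (ℚ; 0ℚ; 1ℚ; _+_; _*_; _-_; -_; ≢-nonZero)
import Data.Rational.Properties as ℚP
open import Algebra.Bundles using (CommutativeMonoid)
open import Algebra.Properties.CommutativeSemigroup (CommutativeMonoid.commutativeSemigroup ℚP.*-1-commutativeMonoid) using (interchange)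
open import Algebra.Properties.Group ℚP.+-0-group using (x∙y⁻¹≈ε⇒x≈y)
open import Data.Empty using (⊥-elim)
open import Data.Maybe using (Maybe; just; nothing)
open import Data.Product using (_,_)
open import Data.Sum using (_⊎_; inj₁; inj₂)
open import Level using (0ℓ)
open import Relation.Binary.PropositionalEquality
open import Relation.Nullary using (Dec; yes; no)
open import Tactic.RingSolver using (solve-∀)
open import Tactic.RingSolver.Core.AlmostCommutativeRing using (AlmostCommutativeRing; fromCommutativeRing)

ℚ-ring : AlmostCommutativeRing 0ℓ 0ℓ
ℚ-ring = fromCommutativeRing ℚP.+-*-commutativeRing 0≡?
  where
  0≡? : (x : ℚ) → Maybe (0ℚ ≡ x)
  0≡? x with x ℚP.≟ 0ℚ
  ... | yes x≡0 = just (sym x≡0)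
  ... | no _ = nothing

inv-inverseʳ : ∀ p → p ≢ 0ℚ → p * inv p ≡ 1ℚ
inv-inverseʳ p p≢0 with p ℚP.≟ 0ℚ
... | yes p≡0 = ⊥-elim (p≢0 p≡0)
... | no p≢0′ = ℚP.*-inverseʳ p {{≢-nonZero p≢0′}}

inv-inverseˡ : ∀ p → p ≢ 0ℚ → inv p * p ≡ 1ℚ
inv-inverseˡ p p≢0 = trans (ℚP.*-comm (inv p) p) (inv-inverseʳ p p≢0)

*-≢0 : ∀ {p r} → p ≢ 0ℚ → r ≢ 0ℚ → p * r ≢ 0ℚ
*-≢0 {p} {r} p≢0 r≢0 pr≡0 = r≢0 (begin
  r                ≡⟨ ℚP.*-identityˡ r ⟨
  1ℚ * r           ≡⟨ cong (_* r) (inv-inverseˡ p p≢0) ⟨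
  inv p * p * r    ≡⟨ ℚP.*-assoc (inv p) p r ⟩
  inv p * (p * r)  ≡⟨ cong (inv p *_) pr≡0 ⟩
  inv p * 0ℚ       ≡⟨ ℚP.*-zeroʳ (inv p) ⟩
  0ℚ               ∎)
  where open ≡-Reasoning

x*[y*0]≡0 : ∀ x y → x * (y * 0ℚ) ≡ 0ℚ
x*[y*0]≡0 x y = trans (cong (x *_) (ℚP.*-zeroʳ y)) (ℚP.*-zeroʳ x)

x*[0*y]≡0 : ∀ x y → x * (0ℚ * y) ≡ 0ℚ
x*[0*y]≡0 x y = trans (cong (x *_) (ℚP.*-zeroˡ y)) (ℚP.*-zeroʳ x)

x≡y*d⇒x*inv[d]≡y : ∀ {x y d} → d ≢ 0ℚ → x ≡ y * d → x * inv d ≡ y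
x≡y*d⇒x*inv[d]≡y {x} {y} {d} d≢0 x≡y*d = begin
  x * inv d        ≡⟨ cong (_* inv d) x≡y*d ⟩
  y * d * inv d    ≡⟨ ℚP.*-assoc y d (inv d) ⟩
  y * (d * inv d)  ≡⟨ cong (y *_) (inv-inverseʳ d d≢0) ⟩
  y * 1ℚ           ≡⟨ ℚP.*-identityʳ y ⟩
  y                ∎
  where open ≡-Reasoning

^-distribˡ-+-* : ∀ x m n → x ^ (m +ℕ n) ≡ x ^ m * x ^ n
^-distribˡ-+-* x zero n = sym (ℚP.*-identityˡ (x ^ n))
^-distribˡ-+-* x (suc m) n =
  trans (cong (x *_) (^-distribˡ-+-* x m n)) (sym (ℚP.*-assoc x (x ^ m) (x ^ n)))

^-distribʳ-* : ∀ x y n → (x * y) ^ n ≡ x ^ n * y ^ n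
^-distribʳ-* x y zero = refl
^-distribʳ-* x y (suc n) =
  trans (cong ((x * y) *_) (^-distribʳ-* x y n)) (interchange x y (x ^ n) (y ^ n))

1^n≡1 : ∀ n → 1ℚ ^ n ≡ 1ℚ
1^n≡1 zero = refl
1^n≡1 (suc n) = cong (1ℚ *_) (1^n≡1 n)

^-exponents : ∀ x a b c d → a +ℕ b ≡ c +ℕ d → x ^ a * x ^ b ≡ x ^ c * x ^ d
^-exponents x a b c d a+b≡c+d =
  trans (sym (^-distribˡ-+-* x a b)) (trans (cong (x ^_) a+b≡c+d) (^-distribˡ-+-* x c d))

sign : ℕ → ℚ
sign k = (- 1ℚ) ^ k

sign*sign≡1 : ∀ k → sign k * sign k ≡ 1ℚ
sign*sign≡1 k = trans (sym (^-distribʳ-* (- 1ℚ) (- 1ℚ) k)) (1^n≡1 k)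

sign²-cancel : ∀ Z s t D B u P → s * s ≡ 1ℚ → Z * (((s * t) * D) * (s * B * (u * P))) ≡ Z * t * D * B * u * P
sign²-cancel Z s t D B u P s²≡1 = begin
  Z * (((s * t) * D) * (s * B * (u * P)))   ≡⟨ extract Z s t D B u P ⟩
  (s * s) * (Z * t * D * B * u * P)         ≡⟨ cong (_* (Z * t * D * B * u * P)) s²≡1 ⟩
  1ℚ * (Z * t * D * B * u * P)              ≡⟨ ℚP.*-identityˡ (Z * t * D * B * u * P) ⟩
  Z * t * D * B * u * P                     ∎
  where
  open ≡-Reasoning
  extract : ∀ Z s t D B u P → Z * (((s * t) * D) * (s * B * (u * P))) ≡ (s * s) * (Z * t * D * B * u * P)
  extract = solve-∀ ℚ-ring

^ℤ-⊖ : ∀ u → u ≢ 0ℚ → ∀ m n → u ^ℤ (m ℤ.⊖ n) ≡ u ^ m * inv u ^ n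
^ℤ-⊖ u u≢0 m zero = sym (ℚP.*-identityʳ (u ^ m))
^ℤ-⊖ u u≢0 zero (suc n) = sym (ℚP.*-identityˡ (inv u ^ suc n))
^ℤ-⊖ u u≢0 (suc m) (suc n) = begin
  u ^ℤ (suc m ℤ.⊖ suc n)                ≡⟨ cong (u ^ℤ_) (ℤP.[1+m]⊖[1+n]≡m⊖n m n) ⟩
  u ^ℤ (m ℤ.⊖ n)                        ≡⟨ ^ℤ-⊖ u u≢0 m n ⟩
  u ^ m * inv u ^ n                     ≡⟨ ℚP.*-identityˡ _ ⟨
  1ℚ * (u ^ m * inv u ^ n)              ≡⟨ cong (_* (u ^ m * inv u ^ n)) (inv-inverseʳ u u≢0) ⟨
  u * inv u * (u ^ m * inv u ^ n)       ≡⟨ interchange u (inv u) (u ^ m) (inv u ^ n) ⟩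
  u * u ^ m * (inv u * inv u ^ n)       ∎
  where open ≡-Reasoning

^ℤ-distribˡ-+-* : ∀ u → u ≢ 0ℚ → ∀ a b → u ^ℤ (a ℤ.+ b) ≡ u ^ℤ a * u ^ℤ b
^ℤ-distribˡ-+-* u u≢0 (+ m) (+ n) = ^-distribˡ-+-* u m n
^ℤ-distribˡ-+-* u u≢0 (+ m) -[1+ n ] = ^ℤ-⊖ u u≢0 m (suc n)
^ℤ-distribˡ-+-* u u≢0 -[1+ m ] (+ n) =
  trans (^ℤ-⊖ u u≢0 n (suc m)) (ℚP.*-comm (u ^ n) (inv u ^ suc m))
^ℤ-distribˡ-+-* u u≢0 -[1+ m ] -[1+ n ] =
  trans (cong (λ e → inv u ^ suc e) (sym (ℕP.+-suc m n))) (^-distribˡ-+-* (inv u) (suc m) (suc n))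

signℤ-even : ∀ a b → (- 1ℚ) ^ℤ (a ℤ.+ (b ℤ.+ b)) ≡ (- 1ℚ) ^ℤ a
signℤ-even a b = begin
  (- 1ℚ) ^ℤ (a ℤ.+ (b ℤ.+ b))              ≡⟨ ^ℤ-distribˡ-+-* (- 1ℚ) (λ ()) a (b ℤ.+ b) ⟩
  (- 1ℚ) ^ℤ a * (- 1ℚ) ^ℤ (b ℤ.+ b)        ≡⟨ cong ((- 1ℚ) ^ℤ a *_) (trans (^ℤ-distribˡ-+-* (- 1ℚ) (λ ()) b b) (square b)) ⟩
  (- 1ℚ) ^ℤ a * 1ℚ                         ≡⟨ ℚP.*-identityʳ _ ⟩
  (- 1ℚ) ^ℤ a                              ∎
  where
  open ≡-Reasoning
  square : ∀ b → (- 1ℚ) ^ℤ b * (- 1ℚ) ^ℤ b ≡ 1ℚ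
  square (+ n) = sign*sign≡1 n
  square -[1+ n ] = sign*sign≡1 (suc n)

tri : ℕ → ℕ
tri zero = zero
tri (suc n) = suc n +ℕ tri n

choose₂ : ℕ → ℕ
choose₂ zero = zero
choose₂ (suc n) = tri n

tri≡choose₂+n : ∀ n → tri n ≡ choose₂ n +ℕ n
tri≡choose₂+n zero = refl
tri≡choose₂+n (suc n) = ℕP.+-comm (suc n) (tri n)

tri*2≡n*[1+n] : ∀ n → tri n *ℕ 2 ≡ n *ℕ suc n
tri*2≡n*[1+n] zero = refl
tri*2≡n*[1+n] (suc n) = begin
  (suc n +ℕ tri n) *ℕ 2        ≡⟨ ℕP.*-distribʳ-+ 2 (suc n) (tri n) ⟩
  suc n *ℕ 2 +ℕ tri n *ℕ 2     ≡⟨ cong (suc n *ℕ 2 +ℕ_) (tri*2≡n*[1+n] n) ⟩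
  suc n *ℕ 2 +ℕ n *ℕ suc n     ≡⟨ distribute n ⟩
  suc n *ℕ suc (suc n)         ∎
  where
  open ≡-Reasoning
  distribute : ∀ n → suc n *ℕ 2 +ℕ n *ℕ suc n ≡ suc n *ℕ suc (suc n)
  distribute = ℕSolver.solve-∀

-- T (-[1+ n ]) = T (+ n) = tri n.
Tℕ : ℤ → ℕ
Tℕ (+ n) = tri n
Tℕ -[1+ n ] = tri n

T≡Tℕ : ∀ x → T x ≡ + Tℕ x
T≡Tℕ x = begin
  T x                               ≡⟨ ℤD.div-pos-is-/ℕ (x ℤ.* (x ℤ.+ + 1)) 2 ⟩
  (x ℤ.* (x ℤ.+ + 1)) ℤ./ℕ 2        ≡⟨ cong (ℤ._/ℕ 2) (twiceT x) ⟩
  + (Tℕ x *ℕ 2) ℤ./ℕ 2              ≡⟨ cong +_ (ℕD.m*n/n≡m (Tℕ x) 2) ⟩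
  + Tℕ x                            ∎
  where
  open ≡-Reasoning
  twiceT : ∀ x → x ℤ.* (x ℤ.+ + 1) ≡ + (Tℕ x *ℕ 2)
  twiceT (+ n) = begin
    + n ℤ.* + (n +ℕ 1)     ≡⟨ ℤP.pos-* n (n +ℕ 1) ⟨
    + (n *ℕ (n +ℕ 1))      ≡⟨ cong (λ t → + (n *ℕ t)) (ℕP.+-comm n 1) ⟩
    + (n *ℕ suc n)         ≡⟨ cong +_ (tri*2≡n*[1+n] n) ⟨
    + (tri n *ℕ 2)         ∎
  twiceT -[1+ zero ] = refl
  twiceT -[1+ suc n ] = cong +_ (trans (ℕP.*-comm (suc (suc n)) (suc n)) (sym (tri*2≡n*[1+n] (suc n))))

Tℕ-suc : ∀ y → + Tℕ (y ℤ.+ + 1) ≡ + Tℕ y ℤ.+ (y ℤ.+ + 1)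
Tℕ-suc (+ k) = cong +_ (begin
  tri (k +ℕ 1)         ≡⟨ cong tri (ℕP.+-comm k 1) ⟩
  suc k +ℕ tri k       ≡⟨ ℕP.+-comm (suc k) (tri k) ⟩
  tri k +ℕ suc k       ≡⟨ cong (tri k +ℕ_) (ℕP.+-comm 1 k) ⟩
  tri k +ℕ (k +ℕ 1)    ∎)
  where open ≡-Reasoning
Tℕ-suc -[1+ zero ] = refl
Tℕ-suc -[1+ suc k ] = cancel (+ tri k) (+ suc k)
  where
  cancel : ∀ a b → a ≡ b ℤ.+ a ℤ.+ ℤ.- b
  cancel = ℤSolver.solve-∀

∸-comm : ∀ m n o → m ∸ n ∸ o ≡ m ∸ o ∸ n
∸-comm m n o = trans (ℕP.∸-+-assoc m n o) (trans (cong (m ∸_) (ℕP.+-comm n o)) (sym (ℕP.∸-+-assoc m o n)))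

m∸n<o⇒m∸o<n : ∀ {m n o} → o ≤ m → m ∸ n < o → m ∸ o < n
m∸n<o⇒m∸o<n {m} {n} {o} o≤m m∸n<o = ℕP.≰⇒> (λ n≤m∸o →
  ℕP.<⇒≱ m∸n<o (ℕP.m+n≤o⇒m≤o∸n o (subst (o +ℕ n ≤_) (ℕP.m+[n∸m]≡n o≤m) (ℕP.+-monoʳ-≤ o n≤m∸o))))

+[m∸n]≡+m-+n : ∀ {m n} → n ≤ m → + (m ∸ n) ≡ + m ℤ.- + n
+[m∸n]≡+m-+n {m} {n} n≤m = trans (sym (ℤP.⊖-≥ n≤m)) (sym (ℤP.m-n≡m⊖n m n))

-[1+m]+[1+n]≡n∸m : ∀ {m n} → m ≤ n → -[1+ m ] ℤ.+ + suc n ≡ + (n ∸ m)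
-[1+m]+[1+n]≡n∸m {m} {n} m≤n = trans (ℤP.[1+m]⊖[1+n]≡m⊖n n m) (ℤP.⊖-≥ m≤n)

Σ< : ℕ → (ℕ → ℚ) → ℚ
Σ< zero f = 0ℚ
Σ< (suc n) f = Σ< n f + f n

Σ<-cong : ∀ n {f g : ℕ → ℚ} → (∀ k → k < n → f k ≡ g k) → Σ< n f ≡ Σ< n g
Σ<-cong zero f≗g = refl
Σ<-cong (suc n) f≗g = cong₂ _+_ (Σ<-cong n (λ k k<n → f≗g k (ℕP.m<n⇒m<1+n k<n))) (f≗g n ℕP.≤-refl)

Σ<-zero : ∀ n {f : ℕ → ℚ} → (∀ k → k < n → f k ≡ 0ℚ) → Σ< n f ≡ 0ℚ
Σ<-zero zero f≗0 = refl
Σ<-zero (suc n) f≗0 = cong₂ _+_ (Σ<-zero n (λ k k<n → f≗0 k (ℕP.m<n⇒m<1+n k<n))) (f≗0 n ℕP.≤-refl)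

Σ<-+ : ∀ n (f g : ℕ → ℚ) → Σ< n (λ k → f k + g k) ≡ Σ< n f + Σ< n g
Σ<-+ zero f g = refl
Σ<-+ (suc n) f g = trans (cong (_+ (f n + g n)) (Σ<-+ n f g)) (regroup (Σ< n f) (Σ< n g) (f n) (g n))
  where
  regroup : ∀ a b c d → (a + b) + (c + d) ≡ (a + c) + (b + d)
  regroup = solve-∀ ℚ-ring

Σ<-- : ∀ n (f g : ℕ → ℚ) → Σ< n (λ k → f k - g k) ≡ Σ< n f - Σ< n g
Σ<-- zero f g = refl
Σ<-- (suc n) f g = trans (cong (_+ (f n - g n)) (Σ<-- n f g)) (regroup (Σ< n f) (Σ< n g) (f n) (g n))
  where
  regroup : ∀ a b c d → (a - b) + (c - d) ≡ (a + c) - (b + d)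
  regroup = solve-∀ ℚ-ring

Σ<-*ˡ : ∀ n a (f : ℕ → ℚ) → Σ< n (λ k → a * f k) ≡ a * Σ< n f
Σ<-*ˡ zero a f = sym (ℚP.*-zeroʳ a)
Σ<-*ˡ (suc n) a f = trans (cong (_+ (a * f n)) (Σ<-*ˡ n a f)) (sym (ℚP.*-distribˡ-+ a (Σ< n f) (f n)))

Σ<-head : ∀ n (f : ℕ → ℚ) → Σ< (suc n) f ≡ f 0 + Σ< n (λ k → f (suc k))
Σ<-head zero f = trans (ℚP.+-identityˡ (f 0)) (sym (ℚP.+-identityʳ (f 0)))
Σ<-head (suc n) f = trans (cong (_+ f (suc n)) (Σ<-head n f)) (ℚP.+-assoc (f 0) _ _)

Σ<-split : ∀ m n (f : ℕ → ℚ) → Σ< (m +ℕ n) f ≡ Σ< m f + Σ< n (λ k → f (m +ℕ k))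
Σ<-split m zero f = trans (cong (λ t → Σ< t f) (ℕP.+-identityʳ m)) (sym (ℚP.+-identityʳ _))
Σ<-split m (suc n) f = begin
  Σ< (m +ℕ suc n) f                                  ≡⟨ cong (λ t → Σ< t f) (ℕP.+-suc m n) ⟩
  Σ< (m +ℕ n) f + f (m +ℕ n)                         ≡⟨ cong (_+ f (m +ℕ n)) (Σ<-split m n f) ⟩
  (Σ< m f + Σ< n (λ k → f (m +ℕ k))) + f (m +ℕ n)    ≡⟨ ℚP.+-assoc (Σ< m f) _ _ ⟩
  Σ< m f + (Σ< n (λ k → f (m +ℕ k)) + f (m +ℕ n))    ∎
  where open ≡-Reasoning

Σ<-swap : ∀ m n (f : ℕ → ℕ → ℚ) → Σ< m (λ i → Σ< n (f i)) ≡ Σ< n (λ j → Σ< m (λ i → f i j))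
Σ<-swap zero n f = sym (Σ<-zero n (λ _ _ → refl))
Σ<-swap (suc m) n f =
  trans (cong (_+ Σ< n (f m)) (Σ<-swap m n f)) (sym (Σ<-+ n (λ j → Σ< m (λ i → f i j)) (f m)))

Σ<-tail-zero : ∀ {m n} (f : ℕ → ℚ) → m ≤ n → (∀ k → m ≤ k → k < n → f k ≡ 0ℚ) → Σ< n f ≡ Σ< m f
Σ<-tail-zero {m} f m≤n tail≡0 with ℕP.m≤n⇒∃[o]m+o≡n m≤n
... | d , refl = begin
  Σ< (m +ℕ d) f                       ≡⟨ Σ<-split m d f ⟩
  Σ< m f + Σ< d (λ k → f (m +ℕ k))
    ≡⟨ cong (λ x → Σ< m f + x) (Σ<-zero d (λ k k<d → tail≡0 (m +ℕ k) (ℕP.m≤m+n m k) (ℕP.+-monoʳ-< m k<d))) ⟩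
  Σ< m f + 0ℚ                         ≡⟨ ℚP.+-identityʳ _ ⟩
  Σ< m f                              ∎
  where open ≡-Reasoning

Σ<-drop-last : ∀ n (f : ℕ → ℚ) → f n ≡ 0ℚ → Σ< (suc n) f ≡ Σ< n f
Σ<-drop-last n f fn≡0 = trans (cong (λ x → Σ< n f + x) fn≡0) (ℚP.+-identityʳ (Σ< n f))

Σ<-pascal : ∀ n (τ υ ω : ℕ → ℚ) → τ 0 ≡ υ 0 → (∀ k → k < n → τ (suc k) ≡ - ω k + υ (suc k)) →
            Σ< (suc n) τ ≡ Σ< (suc n) υ - Σ< n ω
Σ<-pascal zero τ υ ω τ0≡υ0 step = trans (cong (λ x → 0ℚ + x) τ0≡υ0) (sym (ℚP.+-identityʳ _))
Σ<-pascal (suc n) τ υ ω τ0≡υ0 step = begin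
  Σ< (suc n) τ + τ (suc n)
    ≡⟨ cong₂ _+_ (Σ<-pascal n τ υ ω τ0≡υ0 (λ k k<n → step k (ℕP.m<n⇒m<1+n k<n))) (step n ℕP.≤-refl) ⟩
  (Σ< (suc n) υ - Σ< n ω) + (- ω n + υ (suc n))
    ≡⟨ regroup (Σ< (suc n) υ) (Σ< n ω) (ω n) (υ (suc n)) ⟩
  (Σ< (suc n) υ + υ (suc n)) - (Σ< n ω + ω n)
    ∎
  where
  open ≡-Reasoning
  regroup : ∀ a b c d → (a - b) + (- c + d) ≡ (a + d) - (b + c)
  regroup = solve-∀ ℚ-ring

Σ<-triangle : ∀ N (f : ℕ → ℕ → ℚ) →
              Σ< (suc N) (λ u → Σ< (suc u) (f u)) ≡ Σ< (suc N) (λ v → Σ< (suc (N ∸ v)) (λ t → f (v +ℕ t) v))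
Σ<-triangle zero f = refl
Σ<-triangle (suc N) f = begin
  Σ< (suc N) (λ u → Σ< (suc u) (f u)) + Σ< (suc (suc N)) (f (suc N))
    ≡⟨ cong (_+ Σ< (suc (suc N)) (f (suc N))) (Σ<-triangle N f) ⟩
  Σ< (suc N) inner + (Σ< (suc N) (f (suc N)) + f (suc N) (suc N))
    ≡⟨ ℚP.+-assoc (Σ< (suc N) inner) _ _ ⟨
  (Σ< (suc N) inner + Σ< (suc N) (f (suc N))) + f (suc N) (suc N)
    ≡⟨ cong₂ _+_ (sym (Σ<-+ (suc N) inner (f (suc N)))) last ⟩
  Σ< (suc N) (λ v → inner v + f (suc N) v) + Σ< (suc (suc N ∸ suc N)) (λ t → f (suc N +ℕ t) (suc N))
    ≡⟨ cong (_+ Σ< (suc (suc N ∸ suc N)) (λ t → f (suc N +ℕ t) (suc N))) (Σ<-cong (suc N) grow) ⟩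
  Σ< (suc N) (λ v → Σ< (suc (suc N ∸ v)) (λ t → f (v +ℕ t) v)) + Σ< (suc (suc N ∸ suc N)) (λ t → f (suc N +ℕ t) (suc N))
    ∎
  where
  open ≡-Reasoning
  inner : ℕ → ℚ
  inner v = Σ< (suc (N ∸ v)) (λ t → f (v +ℕ t) v)
  last : f (suc N) (suc N) ≡ Σ< (suc (N ∸ N)) (λ t → f (suc N +ℕ t) (suc N))
  last rewrite ℕP.n∸n≡0 N | ℕP.+-identityʳ N = sym (ℚP.+-identityˡ _)
  grow : ∀ v → v < suc N → inner v + f (suc N) v ≡ Σ< (suc (suc N ∸ v)) (λ t → f (v +ℕ t) v)
  grow v (s≤s v≤N) rewrite ℕP.+-∸-assoc 1 v≤N =
    cong (λ u → inner v + f u v) (sym (trans (ℕP.+-suc v (N ∸ v)) (cong suc (ℕP.m+[n∸m]≡n v≤N))))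

Σ<-swap-weighted : ∀ n m Z (a w : ℕ → ℚ) (B : ℕ → ℕ → ℚ) →
  Σ< n (λ t → Z * (a t * Σ< m (λ j → w j * B t j))) ≡ Σ< m (λ j → Z * (w j * Σ< n (λ t → a t * B t j)))
Σ<-swap-weighted n m Z a w B = begin
  Σ< n (λ t → Z * (a t * Σ< m (λ j → w j * B t j)))        ≡⟨ Σ<-cong n (λ t _ → pull-in t) ⟩
  Σ< n (λ t → Σ< m (λ j → Z * (w j * (a t * B t j))))      ≡⟨ Σ<-swap n m (λ t j → Z * (w j * (a t * B t j))) ⟩
  Σ< m (λ j → Σ< n (λ t → Z * (w j * (a t * B t j))))      ≡⟨ Σ<-cong m (λ j _ → pull-out j) ⟩
  Σ< m (λ j → Z * (w j * Σ< n (λ t → a t * B t j)))        ∎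
  where
  open ≡-Reasoning
  regroup : ∀ Z w a b → Z * (a * (w * b)) ≡ Z * (w * (a * b))
  regroup = solve-∀ ℚ-ring
  pull-in : ∀ t → Z * (a t * Σ< m (λ j → w j * B t j)) ≡ Σ< m (λ j → Z * (w j * (a t * B t j)))
  pull-in t = begin
    Z * (a t * Σ< m (λ j → w j * B t j))            ≡⟨ cong (λ x → Z * x) (Σ<-*ˡ m (a t) (λ j → w j * B t j)) ⟨
    Z * Σ< m (λ j → a t * (w j * B t j))            ≡⟨ Σ<-*ˡ m Z (λ j → a t * (w j * B t j)) ⟨
    Σ< m (λ j → Z * (a t * (w j * B t j)))          ≡⟨ Σ<-cong m (λ j _ → regroup Z (w j) (a t) (B t j)) ⟩
    Σ< m (λ j → Z * (w j * (a t * B t j)))          ∎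
  pull-out : ∀ j → Σ< n (λ t → Z * (w j * (a t * B t j))) ≡ Z * (w j * Σ< n (λ t → a t * B t j))
  pull-out j = trans (Σ<-*ˡ n Z (λ t → w j * (a t * B t j))) (cong (λ x → Z * x) (Σ<-*ˡ n (w j) (λ t → a t * B t j)))

sumFrom≡Σ< : ∀ a len (f : ℤ → ℚ) → sumFrom a len f ≡ Σ< len (λ k → f (a ℤ.+ + k))
sumFrom≡Σ< a zero f = refl
sumFrom≡Σ< a (suc len) f = begin
  f a + sumFrom (a ℤ.+ + 1) len f                      ≡⟨ cong (λ x → f a + x) (sumFrom≡Σ< (a ℤ.+ + 1) len f) ⟩
  f a + Σ< len (λ k → f (a ℤ.+ + 1 ℤ.+ + k))
    ≡⟨ cong₂ _+_ (cong f (sym (ℤP.+-identityʳ a))) (Σ<-cong len (λ k _ → cong f (ℤP.+-assoc a (+ 1) (+ k)))) ⟩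
  f (a ℤ.+ + 0) + Σ< len (λ k → f (a ℤ.+ + suc k))     ≡⟨ Σ<-head len (λ k → f (a ℤ.+ + k)) ⟨
  Σ< (suc len) (λ k → f (a ℤ.+ + k))                   ∎
  where open ≡-Reasoning

Σ[⋯]≡Σ< : ∀ a u (g : ℤ → ℚ) → Σ[ a ⋯ a ℤ.+ + u ] g ≡ Σ< (suc u) (λ v → g (a ℤ.+ + v))
Σ[⋯]≡Σ< a u g with a ℤ.≤? a ℤ.+ + u
... | no a≰a+u = ⊥-elim (a≰a+u (ℤP.i≤i+j a (+ u)))
... | yes _ = trans (cong (λ l → sumFrom a l g) (cong ℤ.∣_∣ (length a (+ u)))) (sumFrom≡Σ< a (suc u) g)
  where
  length : ∀ a b → a ℤ.+ b ℤ.- a ℤ.+ + 1 ≡ + 1 ℤ.+ b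
  length = ℤSolver.solve-∀

Σℕ≡Σ< : ∀ b (f : ℕ → ℚ) → Σℕ[0⋯ b ] f ≡ Σ< (suc b) f
Σℕ≡Σ< zero f = sym (ℚP.+-identityˡ (f 0))
Σℕ≡Σ< (suc b) f = cong (_+ f (suc b)) (Σℕ≡Σ< b f)

-- The Gaussian binomial by q-Pascal recursion: it involves no division, so its identities need no
-- hypothesis on q; qbinom≡qbin identifies it with qbinom.
qbin : ℚ → ℕ → ℕ → ℚ
qbin q n zero = 1ℚ
qbin q zero (suc k) = 0ℚ
qbin q (suc n) (suc k) = qbin q n k + q ^ suc k * qbin q n (suc k)

absorption-step : ∀ A B C q t u → (1ℚ - q * t) * A ≡ (1ℚ - u) * B → (1ℚ - t) * B ≡ (1ℚ - q * u) * C →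
                  (1ℚ - q * t) * (A + u * B) ≡ (1ℚ - q * u) * (B + q * u * C)
absorption-step A B C q t u hA hC = begin
  (1ℚ - q * t) * (A + u * B)                 ≡⟨ expandˡ A B q t u ⟩
  (1ℚ - q * t) * A + (1ℚ - q * t) * u * B    ≡⟨ cong (λ x → x + (1ℚ - q * t) * u * B) hA ⟩
  (1ℚ - u) * B + (1ℚ - q * t) * u * B        ≡⟨ collect B C q t u ⟩
  (1ℚ - q * u) * B + q * u * ((1ℚ - t) * B)  ≡⟨ cong (λ x → (1ℚ - q * u) * B + q * u * x) hC ⟩
  (1ℚ - q * u) * B + q * u * ((1ℚ - q * u) * C) ≡⟨ expandʳ B C q u ⟨
  (1ℚ - q * u) * (B + q * u * C)             ∎
  where
  open ≡-Reasoning
  expandˡ : ∀ A B q t u → (1ℚ - q * t) * (A + u * B) ≡ (1ℚ - q * t) * A + (1ℚ - q * t) * u * B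
  expandˡ = solve-∀ ℚ-ring
  collect : ∀ B C q t u → (1ℚ - u) * B + (1ℚ - q * t) * u * B ≡ (1ℚ - q * u) * B + q * u * ((1ℚ - t) * B)
  collect = solve-∀ ℚ-ring
  expandʳ : ∀ B C q u → (1ℚ - q * u) * (B + q * u * C) ≡ (1ℚ - q * u) * B + q * u * ((1ℚ - q * u) * C)
  expandʳ = solve-∀ ℚ-ring

module _ (q : ℚ) where

  qbin-vanish : ∀ n k → n < k → qbin q n k ≡ 0ℚ
  qbin-vanish zero (suc k) _ = refl
  qbin-vanish (suc n) (suc k) (s≤s n<k) = begin
    qbin q n k + q ^ suc k * qbin q n (suc k)  ≡⟨ cong₂ (λ a b → a + q ^ suc k * b) (qbin-vanish n k n<k) (qbin-vanish n (suc k) (ℕP.m<n⇒m<1+n n<k)) ⟩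
    0ℚ + q ^ suc k * 0ℚ                        ≡⟨ cong (λ x → 0ℚ + x) (ℚP.*-zeroʳ (q ^ suc k)) ⟩
    0ℚ                                         ∎
    where open ≡-Reasoning

  qbin-diag : ∀ n → qbin q n n ≡ 1ℚ
  qbin-diag zero = refl
  qbin-diag (suc n) = begin
    qbin q n n + q ^ suc n * qbin q n (suc n)  ≡⟨ cong₂ (λ a b → a + q ^ suc n * b) (qbin-diag n) (qbin-vanish n (suc n) ℕP.≤-refl) ⟩
    1ℚ + q ^ suc n * 0ℚ                        ≡⟨ cong (λ x → 1ℚ + x) (ℚP.*-zeroʳ (q ^ suc n)) ⟩
    1ℚ                                         ∎
    where open ≡-Reasoning

  qbin-absorption : ∀ n k → (1ℚ - q ^ (n ∸ k)) * qbin q n k ≡ (1ℚ - q ^ suc k) * qbin q n (suc k)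
  qbin-absorption n k with n ℕP.≤? k
  ... | yes n≤k = begin
    (1ℚ - q ^ (n ∸ k)) * qbin q n k        ≡⟨ cong (λ e → (1ℚ - q ^ e) * qbin q n k) (ℕP.m≤n⇒m∸n≡0 n≤k) ⟩
    0ℚ * qbin q n k                        ≡⟨ ℚP.*-zeroˡ (qbin q n k) ⟩
    0ℚ                                     ≡⟨ ℚP.*-zeroʳ (1ℚ - q ^ suc k) ⟨
    (1ℚ - q ^ suc k) * 0ℚ                  ≡⟨ cong ((1ℚ - q ^ suc k) *_) (qbin-vanish n (suc k) (s≤s n≤k)) ⟨
    (1ℚ - q ^ suc k) * qbin q n (suc k)    ∎
    where open ≡-Reasoning
  qbin-absorption zero k | no 0≰k = ⊥-elim (0≰k z≤n)
  qbin-absorption (suc n) zero | no _ = begin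
    (1ℚ - q * q ^ n) * 1ℚ                           ≡⟨ peel q (q ^ n) ⟩
    (1ℚ - q) + q * ((1ℚ - q ^ n) * 1ℚ)              ≡⟨ cong (λ t → (1ℚ - q) + q * t) (qbin-absorption n zero) ⟩
    (1ℚ - q) + q * ((1ℚ - q * 1ℚ) * qbin q n 1)     ≡⟨ factor q (qbin q n 1) ⟩
    (1ℚ - q * 1ℚ) * (1ℚ + q * 1ℚ * qbin q n 1)      ∎
    where
    open ≡-Reasoning
    peel : ∀ q a → (1ℚ - q * a) * 1ℚ ≡ (1ℚ - q) + q * ((1ℚ - a) * 1ℚ)
    peel = solve-∀ ℚ-ring
    factor : ∀ q x → (1ℚ - q) + q * ((1ℚ - q * 1ℚ) * x) ≡ (1ℚ - q * 1ℚ) * (1ℚ + q * 1ℚ * x)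
    factor = solve-∀ ℚ-ring
  qbin-absorption (suc n) (suc k) | no sn≰sk = begin
    (1ℚ - q ^ (n ∸ k)) * (A + q ^ suc k * B)         ≡⟨ cong (λ e → (1ℚ - q ^ e) * (A + q ^ suc k * B)) n∸k≡1+d ⟩
    (1ℚ - q * q ^ d) * (A + q ^ suc k * B)           ≡⟨ absorption-step A B C q (q ^ d) (q ^ suc k) shifted (qbin-absorption n (suc k)) ⟩
    (1ℚ - q * q ^ suc k) * (B + q * q ^ suc k * C)   ∎
    where
    open ≡-Reasoning
    A = qbin q n k
    B = qbin q n (suc k)
    C = qbin q n (suc (suc k))
    d = n ∸ suc k
    n∸k≡1+d : n ∸ k ≡ suc d
    n∸k≡1+d = ℕP.+-∸-assoc 1 (ℕP.≤-pred (ℕP.≰⇒> sn≰sk))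
    shifted : (1ℚ - q * q ^ d) * A ≡ (1ℚ - q ^ suc k) * B
    shifted = trans (cong (λ e → (1ℚ - q ^ e) * A) (sym n∸k≡1+d)) (qbin-absorption n k)

  qbin-pascal′ : ∀ n k → qbin q (suc n) (suc k) ≡ q ^ (n ∸ k) * qbin q n k + qbin q n (suc k)
  qbin-pascal′ n k = swap (qbin q n k) (qbin q n (suc k)) (q ^ (n ∸ k)) (q ^ suc k) (qbin-absorption n k)
    where
    swap : ∀ A B p u → (1ℚ - p) * A ≡ (1ℚ - u) * B → A + u * B ≡ p * A + B
    swap A B p u h = begin
      A + u * B                                     ≡⟨ split A B p u ⟩
      (p * A + B) + ((1ℚ - p) * A - (1ℚ - u) * B)   ≡⟨ cong (λ x → (p * A + B) + (x - (1ℚ - u) * B)) h ⟩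
      (p * A + B) + ((1ℚ - u) * B - (1ℚ - u) * B)   ≡⟨ cancel (p * A + B) ((1ℚ - u) * B) ⟩
      p * A + B                                     ∎
      where
      open ≡-Reasoning
      split : ∀ A B p u → A + u * B ≡ (p * A + B) + ((1ℚ - p) * A - (1ℚ - u) * B)
      split = solve-∀ ℚ-ring
      cancel : ∀ a b → a + (b - b) ≡ a
      cancel = solve-∀ ℚ-ring

  qbin*poch*poch : ∀ k m → qbin q (k +ℕ m) k * (poch q q k * poch q q m) ≡ poch q q (k +ℕ m)
  qbin*poch*poch zero m = trans (ℚP.*-identityˡ _) (ℚP.*-identityˡ (poch q q m))
  qbin*poch*poch (suc k) zero = begin
    qbin q (suc k +ℕ 0) (suc k) * (poch q q (suc k) * 1ℚ)  ≡⟨ cong (λ t → qbin q t (suc k) * (poch q q (suc k) * 1ℚ)) (ℕP.+-identityʳ (suc k)) ⟩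
    qbin q (suc k) (suc k) * (poch q q (suc k) * 1ℚ)       ≡⟨ cong₂ _*_ (qbin-diag (suc k)) (ℚP.*-identityʳ (poch q q (suc k))) ⟩
    1ℚ * poch q q (suc k)                                  ≡⟨ ℚP.*-identityˡ _ ⟩
    poch q q (suc k)                                       ≡⟨ cong (poch q q) (ℕP.+-identityʳ (suc k)) ⟨
    poch q q (suc k +ℕ 0)                                  ∎
    where open ≡-Reasoning
  qbin*poch*poch (suc k) (suc m) = begin
    (A + u * B) * ((P k * (1ℚ - u)) * (P m * (1ℚ - v)))
      ≡⟨ expand A B u v (P k) (P m) ⟩
    (1ℚ - u) * (A * (P k * (P m * (1ℚ - v)))) + u * (1ℚ - v) * (B * ((P k * (1ℚ - u)) * P m))
      ≡⟨ cong₂ (λ x y → (1ℚ - u) * x + u * (1ℚ - v) * y) shorter-m shorter-k ⟩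
    (1ℚ - u) * P (suc (k +ℕ m)) + u * (1ℚ - v) * P (suc (k +ℕ m))
      ≡⟨ collect u v (P (suc (k +ℕ m))) ⟩
    P (suc (k +ℕ m)) * (1ℚ - u * v)
      ≡⟨ cong (λ x → P (suc (k +ℕ m)) * (1ℚ - x)) (trans (sym (^-distribˡ-+-* q (suc k) (suc m))) (cong (λ e → q ^ suc e) (ℕP.+-suc k m))) ⟩
    P (suc (suc (k +ℕ m)))
      ≡⟨ cong (λ e → P (suc e)) (ℕP.+-suc k m) ⟨
    P (suc k +ℕ suc m)
      ∎
    where
    open ≡-Reasoning
    P : ℕ → ℚ
    P = poch q q
    A = qbin q (k +ℕ suc m) k
    B = qbin q (k +ℕ suc m) (suc k)
    u = q ^ suc k
    v = q ^ suc m
    shorter-m : A * (P k * (P m * (1ℚ - v))) ≡ P (suc (k +ℕ m))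
    shorter-m = trans (qbin*poch*poch k (suc m)) (cong P (ℕP.+-suc k m))
    shorter-k : B * ((P k * (1ℚ - u)) * P m) ≡ P (suc (k +ℕ m))
    shorter-k = trans (cong (λ t → qbin q t (suc k) * ((P k * (1ℚ - u)) * P m)) (ℕP.+-suc k m)) (qbin*poch*poch (suc k) m)
    expand : ∀ A B u v a b → (A + u * B) * ((a * (1ℚ - u)) * (b * (1ℚ - v)))
                           ≡ (1ℚ - u) * (A * (a * (b * (1ℚ - v)))) + u * (1ℚ - v) * (B * ((a * (1ℚ - u)) * b))
    expand = solve-∀ ℚ-ring
    collect : ∀ u v Q → (1ℚ - u) * Q + u * (1ℚ - v) * Q ≡ Q * (1ℚ - u * v)
    collect = solve-∀ ℚ-ring

  qbin⁺ : ℕ → ℕ → ℚ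
  qbin⁺ x y = qbin q (x +ℕ y) x

  qbin⁺-zeroʳ : ∀ x → qbin⁺ x 0 ≡ 1ℚ
  qbin⁺-zeroʳ x = trans (cong (λ t → qbin q t x) (ℕP.+-identityʳ x)) (qbin-diag x)

  qbin⁺-pascal : ∀ x y → qbin⁺ (suc x) (suc y) ≡ qbin⁺ x (suc y) + q ^ suc x * qbin⁺ (suc x) y
  qbin⁺-pascal x y = cong (λ t → qbin⁺ x (suc y) + q ^ suc x * qbin q t (suc x)) (ℕP.+-suc x y)

  qbin⁺-pascal′ : ∀ x y → qbin⁺ (suc x) (suc y) ≡ q ^ suc y * qbin⁺ x (suc y) + qbin⁺ (suc x) y
  qbin⁺-pascal′ x y = trans (qbin-pascal′ (x +ℕ suc y) x)
    (cong₂ (λ e t → q ^ e * qbin⁺ x (suc y) + qbin q t (suc x)) (ℕP.m+n∸m≡n x (suc y)) (ℕP.+-suc x y))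

  qbin⁺-comm : ∀ x y → qbin⁺ x y ≡ qbin⁺ y x
  qbin⁺-comm zero zero = refl
  qbin⁺-comm zero (suc y) = sym (qbin⁺-zeroʳ (suc y))
  qbin⁺-comm (suc x) zero = qbin⁺-zeroʳ (suc x)
  qbin⁺-comm (suc x) (suc y) = begin
    qbin⁺ (suc x) (suc y)                              ≡⟨ qbin⁺-pascal x y ⟩
    qbin⁺ x (suc y) + q ^ suc x * qbin⁺ (suc x) y      ≡⟨ cong₂ (λ a b → a + q ^ suc x * b) (qbin⁺-comm x (suc y)) (qbin⁺-comm (suc x) y) ⟩
    qbin⁺ (suc y) x + q ^ suc x * qbin⁺ y (suc x)      ≡⟨ ℚP.+-comm (qbin⁺ (suc y) x) _ ⟩
    q ^ suc x * qbin⁺ y (suc x) + qbin⁺ (suc y) x      ≡⟨ qbin⁺-pascal′ y x ⟨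
    qbin⁺ (suc y) (suc x)                              ∎
    where open ≡-Reasoning

  -- Both sides of the trinomial revision [x+y+w, x+y] [x+y, x] = [x+y+w, x] [y+w, y] satisfy the same
  -- three-term recurrence and the same boundary values.
  trinomialˡ trinomialʳ : ℕ → ℕ → ℕ → ℚ
  trinomialˡ x y w = qbin⁺ (x +ℕ y) w * qbin⁺ x y
  trinomialʳ x y w = qbin⁺ x (y +ℕ w) * qbin⁺ w y

  trinomialˡ-rec : ∀ x y w → trinomialˡ (suc x) (suc y) (suc w)
                   ≡ trinomialˡ x (suc y) (suc w) + q ^ suc x * trinomialˡ (suc x) y (suc w)
                     + q ^ (suc x +ℕ suc y) * trinomialˡ (suc x) (suc y) w
  trinomialˡ-rec x y w = begin
    qbin⁺ (suc s) (suc w) * X          ≡⟨ cong (_* X) (qbin⁺-pascal s w) ⟩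
    (a + e * b) * X                    ≡⟨ distribʳ a e b X ⟩
    a * X + e * (b * X)                ≡⟨ cong (λ t → a * t + e * (b * X)) (qbin⁺-pascal x y) ⟩
    a * (c + f * d) + e * (b * X)      ≡⟨ cong (_+ e * (b * X)) (distribˡ a c f d) ⟩
    a * c + f * (a * d) + e * (b * X)  ≡⟨ cong (λ t → a * c + f * (qbin⁺ t (suc w) * d) + e * (b * X)) (ℕP.+-suc x y) ⟩
    trinomialˡ x (suc y) (suc w) + f * trinomialˡ (suc x) y (suc w) + e * trinomialˡ (suc x) (suc y) w ∎
    where
    open ≡-Reasoning
    s = x +ℕ suc y
    a = qbin⁺ s (suc w)
    b = qbin⁺ (suc s) w
    c = qbin⁺ x (suc y)
    d = qbin⁺ (suc x) y
    e = q ^ suc s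
    f = q ^ suc x
    X = qbin⁺ (suc x) (suc y)
    distribʳ : ∀ a e b X → (a + e * b) * X ≡ a * X + e * (b * X)
    distribʳ = solve-∀ ℚ-ring
    distribˡ : ∀ a c f d → a * (c + f * d) ≡ a * c + f * (a * d)
    distribˡ = solve-∀ ℚ-ring

  trinomialʳ-rec : ∀ x y w → trinomialʳ (suc x) (suc y) (suc w)
                   ≡ trinomialʳ x (suc y) (suc w) + q ^ suc x * trinomialʳ (suc x) y (suc w)
                     + q ^ (suc x +ℕ suc y) * trinomialʳ (suc x) (suc y) w
  trinomialʳ-rec x y w = begin
    qbin⁺ (suc x) (suc t) * Z                            ≡⟨ cong (_* Z) (qbin⁺-pascal x t) ⟩
    (a + f * b) * Z                                      ≡⟨ distribʳ a f b Z ⟩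
    a * Z + f * (b * Z)                                  ≡⟨ cong (λ u → a * Z + f * (b * u)) (qbin⁺-pascal′ w y) ⟩
    a * Z + f * (b * (g * c + d))                        ≡⟨ expand (a * Z) f b g c d ⟩
    a * Z + f * (b * d) + (f * g) * (b * c)
      ≡⟨ cong₂ (λ h t → a * Z + f * (b * d) + h * (qbin⁺ (suc x) t * c)) (^-distribˡ-+-* q (suc x) (suc y)) (sym (ℕP.+-suc y w)) ⟨
    trinomialʳ x (suc y) (suc w) + f * trinomialʳ (suc x) y (suc w) + q ^ (suc x +ℕ suc y) * trinomialʳ (suc x) (suc y) w ∎
    where
    open ≡-Reasoning
    t = y +ℕ suc w
    a = qbin⁺ x (suc t)
    b = qbin⁺ (suc x) t
    c = qbin⁺ w (suc y)
    d = qbin⁺ (suc w) y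
    f = q ^ suc x
    g = q ^ suc y
    Z = qbin⁺ (suc w) (suc y)
    distribʳ : ∀ a f b Z → (a + f * b) * Z ≡ a * Z + f * (b * Z)
    distribʳ = solve-∀ ℚ-ring
    expand : ∀ A f b g c d → A + f * (b * (g * c + d)) ≡ A + f * (b * d) + (f * g) * (b * c)
    expand = solve-∀ ℚ-ring

  qbin-trinomial : ∀ x y w → trinomialˡ x y w ≡ trinomialʳ x y w
  qbin-trinomial zero y w =
    trans (ℚP.*-identityʳ (qbin⁺ y w)) (trans (qbin⁺-comm y w) (sym (ℚP.*-identityˡ (qbin⁺ w y))))
  qbin-trinomial (suc x) zero w = begin
    qbin⁺ (suc x +ℕ 0) w * qbin⁺ (suc x) 0   ≡⟨ cong₂ (λ t b → qbin⁺ t w * b) (ℕP.+-identityʳ (suc x)) (qbin⁺-zeroʳ (suc x)) ⟩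
    qbin⁺ (suc x) w * 1ℚ                     ≡⟨ cong (qbin⁺ (suc x) w *_) (qbin⁺-zeroʳ w) ⟨
    qbin⁺ (suc x) w * qbin⁺ w 0              ∎
    where open ≡-Reasoning
  qbin-trinomial (suc x) (suc y) zero = begin
    qbin⁺ (suc x +ℕ suc y) 0 * qbin⁺ (suc x) (suc y)  ≡⟨ cong (_* qbin⁺ (suc x) (suc y)) (qbin⁺-zeroʳ (suc x +ℕ suc y)) ⟩
    1ℚ * qbin⁺ (suc x) (suc y)                        ≡⟨ ℚP.*-comm 1ℚ (qbin⁺ (suc x) (suc y)) ⟩
    qbin⁺ (suc x) (suc y) * 1ℚ                        ≡⟨ cong (λ t → qbin⁺ (suc x) t * 1ℚ) (ℕP.+-identityʳ (suc y)) ⟨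
    qbin⁺ (suc x) (suc y +ℕ 0) * qbin⁺ 0 (suc y)      ∎
    where open ≡-Reasoning
  qbin-trinomial (suc x) (suc y) (suc w) = begin
    trinomialˡ (suc x) (suc y) (suc w)
      ≡⟨ trinomialˡ-rec x y w ⟩
    trinomialˡ x (suc y) (suc w) + q ^ suc x * trinomialˡ (suc x) y (suc w) + q ^ (suc x +ℕ suc y) * trinomialˡ (suc x) (suc y) w
      ≡⟨ cong₂ (λ a b → a + q ^ suc x * b + q ^ (suc x +ℕ suc y) * trinomialˡ (suc x) (suc y) w)
               (qbin-trinomial x (suc y) (suc w)) (qbin-trinomial (suc x) y (suc w)) ⟩
    trinomialʳ x (suc y) (suc w) + q ^ suc x * trinomialʳ (suc x) y (suc w) + q ^ (suc x +ℕ suc y) * trinomialˡ (suc x) (suc y) w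
      ≡⟨ cong (λ c → trinomialʳ x (suc y) (suc w) + q ^ suc x * trinomialʳ (suc x) y (suc w) + q ^ (suc x +ℕ suc y) * c)
              (qbin-trinomial (suc x) (suc y) w) ⟩
    trinomialʳ x (suc y) (suc w) + q ^ suc x * trinomialʳ (suc x) y (suc w) + q ^ (suc x +ℕ suc y) * trinomialʳ (suc x) (suc y) w
      ≡⟨ trinomialʳ-rec x y w ⟨
    trinomialʳ (suc x) (suc y) (suc w)
      ∎
    where open ≡-Reasoning

module _ (q : ℚ) where

  altSum : (ℕ → ℕ) → ℕ → ℕ → ℕ → ℚ
  altSum e N M p = Σ< (suc M) (λ k → (sign k * q ^ e k) * (qbin q N k * qbin q (M ∸ k) p))

  pascal-term : ∀ k A B R → (sign (suc k) * q ^ choose₂ (suc k)) * ((A + q ^ suc k * B) * R)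
                          ≡ - ((sign k * q ^ tri k) * (A * R)) + (sign (suc k) * q ^ tri (suc k)) * (B * R)
  pascal-term k A B R = trans (regroup (sign k) (q ^ tri k) (q ^ suc k) A B R)
    (cong (λ x → - ((sign k * q ^ tri k) * (A * R)) + (sign (suc k) * x) * (B * R)) (sym (^-distribˡ-+-* q (suc k) (tri k))))
    where
    regroup : ∀ s t u A B R → ((- 1ℚ) * s * t) * ((A + u * B) * R) ≡ - ((s * t) * (A * R)) + ((- 1ℚ) * s * (u * t)) * (B * R)
    regroup = solve-∀ ℚ-ring

  qbin-difference : ∀ n p → qbin q (suc n) (suc p) - qbin q n (suc p) ≡ q ^ (n ∸ p) * qbin q n p
  qbin-difference n p = trans (cong (_- qbin q n (suc p)) (qbin-pascal′ q n p)) (cancel _ _)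
    where
    cancel : ∀ a b → a + b - b ≡ a
    cancel = solve-∀ ℚ-ring

  choose₂-shift : ∀ M k p → k ≤ M →
    (q ^ tri k * q ^ (M ∸ k ∸ p)) * qbin q (M ∸ k) p ≡ (q ^ choose₂ k * q ^ (M ∸ p)) * qbin q (M ∸ k) p
  choose₂-shift M k p k≤M with p ℕP.≤? M ∸ k
  ... | yes p≤M∸k = cong (_* qbin q (M ∸ k) p) (^-exponents q (tri k) (M ∸ k ∸ p) (choose₂ k) (M ∸ p) (begin
    tri k +ℕ (M ∸ k ∸ p)              ≡⟨ cong (_+ℕ (M ∸ k ∸ p)) (tri≡choose₂+n k) ⟩
    choose₂ k +ℕ k +ℕ (M ∸ k ∸ p)     ≡⟨ ℕP.+-assoc (choose₂ k) k (M ∸ k ∸ p) ⟩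
    choose₂ k +ℕ (k +ℕ (M ∸ k ∸ p))   ≡⟨ cong (choose₂ k +ℕ_) (ℕP.+-∸-assoc k p≤M∸k) ⟨
    choose₂ k +ℕ (k +ℕ (M ∸ k) ∸ p)   ≡⟨ cong (λ m → choose₂ k +ℕ (m ∸ p)) (ℕP.m+[n∸m]≡n k≤M) ⟩
    choose₂ k +ℕ (M ∸ p)              ∎))
    where open ≡-Reasoning
  ... | no p≰M∸k = trans (vanish (q ^ tri k * q ^ (M ∸ k ∸ p))) (sym (vanish (q ^ choose₂ k * q ^ (M ∸ p))))
    where
    vanish : ∀ a → a * qbin q (M ∸ k) p ≡ 0ℚ
    vanish a = trans (cong (a *_) (qbin-vanish q (M ∸ k) p (ℕP.≰⇒> p≰M∸k))) (ℚP.*-zeroʳ a)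

  altSum-tri-difference : ∀ N M p →
    Σ< (suc M) (λ k → (sign k * q ^ tri k) * (qbin q N k * qbin q (suc M ∸ k) (suc p))) - altSum tri N M (suc p)
    ≡ q ^ (M ∸ p) * altSum choose₂ N M p
  altSum-tri-difference N M p =
    trans (sym (Σ<-- (suc M) _ _)) (trans (Σ<-cong (suc M) pointwise) (Σ<-*ˡ (suc M) (q ^ (M ∸ p)) _))
    where
    pointwise : ∀ k → k < suc M →
      (sign k * q ^ tri k) * (qbin q N k * qbin q (suc M ∸ k) (suc p)) - (sign k * q ^ tri k) * (qbin q N k * qbin q (M ∸ k) (suc p))
      ≡ q ^ (M ∸ p) * ((sign k * q ^ choose₂ k) * (qbin q N k * qbin q (M ∸ k) p))
    pointwise k (s≤s k≤M) = begin
      (sign k * q ^ tri k) * (qbin q N k * qbin q (suc M ∸ k) (suc p)) - (sign k * q ^ tri k) * (qbin q N k * qbin q (M ∸ k) (suc p))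
        ≡⟨ cong (λ t → (sign k * q ^ tri k) * (qbin q N k * qbin q t (suc p)) - (sign k * q ^ tri k) * (qbin q N k * qbin q (M ∸ k) (suc p)))
                (ℕP.+-∸-assoc 1 k≤M) ⟩
      (sign k * q ^ tri k) * (qbin q N k * qbin q (suc (M ∸ k)) (suc p)) - (sign k * q ^ tri k) * (qbin q N k * qbin q (M ∸ k) (suc p))
        ≡⟨ factor (sign k * q ^ tri k) (qbin q N k) (qbin q (suc (M ∸ k)) (suc p)) (qbin q (M ∸ k) (suc p)) ⟩
      (sign k * q ^ tri k) * (qbin q N k * (qbin q (suc (M ∸ k)) (suc p) - qbin q (M ∸ k) (suc p)))
        ≡⟨ cong (λ x → (sign k * q ^ tri k) * (qbin q N k * x)) (qbin-difference (M ∸ k) p) ⟩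
      (sign k * q ^ tri k) * (qbin q N k * (q ^ (M ∸ k ∸ p) * qbin q (M ∸ k) p))
        ≡⟨ regroup (sign k) (q ^ tri k) (qbin q N k) (q ^ (M ∸ k ∸ p)) (qbin q (M ∸ k) p) ⟩
      sign k * qbin q N k * ((q ^ tri k * q ^ (M ∸ k ∸ p)) * qbin q (M ∸ k) p)
        ≡⟨ cong (sign k * qbin q N k *_) (choose₂-shift M k p k≤M) ⟩
      sign k * qbin q N k * ((q ^ choose₂ k * q ^ (M ∸ p)) * qbin q (M ∸ k) p)
        ≡⟨ regroup′ (sign k) (qbin q N k) (q ^ choose₂ k) (q ^ (M ∸ p)) (qbin q (M ∸ k) p) ⟩
      q ^ (M ∸ p) * ((sign k * q ^ choose₂ k) * (qbin q N k * qbin q (M ∸ k) p)) ∎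
      where
      open ≡-Reasoning
      factor : ∀ a b c d → a * (b * c) - a * (b * d) ≡ a * (b * (c - d))
      factor = solve-∀ ℚ-ring
      regroup : ∀ s t N u B → (s * t) * (N * (u * B)) ≡ s * N * ((t * u) * B)
      regroup = solve-∀ ℚ-ring
      regroup′ : ∀ s N t u B → s * N * ((t * u) * B) ≡ u * ((s * t) * (N * B))
      regroup′ = solve-∀ ℚ-ring

  altSum-choose₂-vanish : ∀ N M p → p < N → N ≤ M → altSum choose₂ N M p ≡ 0ℚ
  altSum-choose₂-vanish (suc N) M zero _ N<M = begin
    altSum choose₂ (suc N) M 0  ≡⟨ Σ<-pascal M _ a a refl (λ k _ → pascal-term k (qbin q N k) (qbin q N (suc k)) 1ℚ) ⟩
    Σ< M a + a M - Σ< M a       ≡⟨ cancel (Σ< M a) (a M) ⟩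
    a M                         ≡⟨ cong (λ x → (sign M * q ^ tri M) * (x * 1ℚ)) (qbin-vanish q N M N<M) ⟩
    (sign M * q ^ tri M) * (0ℚ * 1ℚ) ≡⟨ x*[0*y]≡0 (sign M * q ^ tri M) 1ℚ ⟩
    0ℚ                          ∎
    where
    open ≡-Reasoning
    a : ℕ → ℚ
    a k = (sign k * q ^ tri k) * (qbin q N k * 1ℚ)
    cancel : ∀ x y → x + y - x ≡ y
    cancel = solve-∀ ℚ-ring
  altSum-choose₂-vanish (suc N) (suc M) (suc p) (s≤s p<N) (s≤s N≤M) = begin
    altSum choose₂ (suc N) (suc M) (suc p)    ≡⟨ Σ<-pascal (suc M) _ υ ω refl step ⟩
    Σ< (suc (suc M)) υ - Σ< (suc M) ω        ≡⟨ cong (_- Σ< (suc M) ω) (Σ<-drop-last (suc M) υ υ-last) ⟩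
    Σ< (suc M) υ - altSum tri N M (suc p)    ≡⟨ altSum-tri-difference N M p ⟩
    q ^ (M ∸ p) * altSum choose₂ N M p       ≡⟨ cong (q ^ (M ∸ p) *_) (altSum-choose₂-vanish N M p p<N N≤M) ⟩
    q ^ (M ∸ p) * 0ℚ                         ≡⟨ ℚP.*-zeroʳ (q ^ (M ∸ p)) ⟩
    0ℚ                                       ∎
    where
    open ≡-Reasoning
    υ ω : ℕ → ℚ
    υ k = (sign k * q ^ tri k) * (qbin q N k * qbin q (suc M ∸ k) (suc p))
    ω k = (sign k * q ^ tri k) * (qbin q N k * qbin q (M ∸ k) (suc p))
    step : ∀ k → k < suc M → (sign (suc k) * q ^ choose₂ (suc k)) * (qbin q (suc N) (suc k) * qbin q (M ∸ k) (suc p))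
                             ≡ - ω k + υ (suc k)
    step k _ = pascal-term k (qbin q N k) (qbin q N (suc k)) (qbin q (M ∸ k) (suc p))
    υ-last : υ (suc M) ≡ 0ℚ
    υ-last = trans (cong (λ x → (sign (suc M) * q ^ tri (suc M)) * (x * qbin q (M ∸ M) (suc p))) (qbin-vanish q N (suc M) (s≤s N≤M)))
                   (x*[0*y]≡0 (sign (suc M) * q ^ tri (suc M)) (qbin q (M ∸ M) (suc p)))

  tri-shift : ∀ N k → (q ^ tri (suc k) * q ^ (N ∸ k)) * qbin q N k ≡ (q ^ tri k * q ^ suc N) * qbin q N k
  tri-shift N k with k ℕP.≤? N
  ... | yes k≤N = cong (_* qbin q N k) (^-exponents q (tri (suc k)) (N ∸ k) (tri k) (suc N) (begin
    suc k +ℕ tri k +ℕ (N ∸ k)    ≡⟨ cong (_+ℕ (N ∸ k)) (ℕP.+-comm (suc k) (tri k)) ⟩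
    tri k +ℕ suc k +ℕ (N ∸ k)    ≡⟨ ℕP.+-assoc (tri k) (suc k) (N ∸ k) ⟩
    tri k +ℕ suc (k +ℕ (N ∸ k))  ≡⟨ cong (λ n → tri k +ℕ suc n) (ℕP.m+[n∸m]≡n k≤N) ⟩
    tri k +ℕ suc N               ∎))
    where open ≡-Reasoning
  ... | no k≰N = trans (vanish (q ^ tri (suc k) * q ^ (N ∸ k))) (sym (vanish (q ^ tri k * q ^ suc N)))
    where
    vanish : ∀ a → a * qbin q N k ≡ 0ℚ
    vanish a = trans (cong (a *_) (qbin-vanish q N k (ℕP.≰⇒> k≰N))) (ℚP.*-zeroʳ a)

  pascal′-term : ∀ N k R → (sign (suc k) * q ^ tri (suc k)) * (qbin q (suc N) (suc k) * R)
                 ≡ - (q ^ suc N * ((sign k * q ^ tri k) * (qbin q N k * R)))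
                   + (sign (suc k) * q ^ tri (suc k)) * (qbin q N (suc k) * R)
  pascal′-term N k R = begin
    (s′ * t′) * (qbin q (suc N) (suc k) * R)
      ≡⟨ cong (λ x → (s′ * t′) * (x * R)) (qbin-pascal′ q N k) ⟩
    (s′ * t′) * ((q ^ (N ∸ k) * qbin q N k + qbin q N (suc k)) * R)
      ≡⟨ expand (sign k) t′ (q ^ (N ∸ k)) (qbin q N k) (qbin q N (suc k)) R ⟩
    - (sign k * ((t′ * q ^ (N ∸ k)) * qbin q N k) * R) + (s′ * t′) * (qbin q N (suc k) * R)
      ≡⟨ cong (λ x → - (sign k * x * R) + (s′ * t′) * (qbin q N (suc k) * R)) (tri-shift N k) ⟩
    - (sign k * ((q ^ tri k * q ^ suc N) * qbin q N k) * R) + (s′ * t′) * (qbin q N (suc k) * R)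
      ≡⟨ regroup (sign k) (q ^ tri k) (q ^ suc N) (qbin q N k) R ((s′ * t′) * (qbin q N (suc k) * R)) ⟩
    - (q ^ suc N * ((sign k * q ^ tri k) * (qbin q N k * R))) + (s′ * t′) * (qbin q N (suc k) * R)
      ∎
    where
    open ≡-Reasoning
    s′ = sign (suc k)
    t′ = q ^ tri (suc k)
    expand : ∀ s t p A B R → ((- 1ℚ) * s * t) * ((p * A + B) * R) ≡ - (s * ((t * p) * A) * R) + ((- 1ℚ) * s * t) * (B * R)
    expand = solve-∀ ℚ-ring
    regroup : ∀ s t u A R X → - (s * ((t * u) * A) * R) + X ≡ - (u * ((s * t) * (A * R))) + X
    regroup = solve-∀ ℚ-ring

  altSum-tri-rec : ∀ N M i → altSum tri (suc N) (suc M) i ≡ altSum tri N (suc M) i - q ^ suc N * altSum tri N M i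
  altSum-tri-rec N M i = begin
    altSum tri (suc N) (suc M) i           ≡⟨ Σ<-pascal (suc M) _ _ ω refl (λ k _ → pascal′-term N k (qbin q (M ∸ k) i)) ⟩
    altSum tri N (suc M) i - Σ< (suc M) ω  ≡⟨ cong (λ x → altSum tri N (suc M) i - x) (Σ<-*ˡ (suc M) (q ^ suc N) _) ⟩
    altSum tri N (suc M) i - q ^ suc N * altSum tri N M i ∎
    where
    open ≡-Reasoning
    ω : ℕ → ℚ
    ω k = q ^ suc N * ((sign k * q ^ tri k) * (qbin q N k * qbin q (M ∸ k) i))

  altSum-tri-extend : ∀ N M i → i ≤ N → N ≤ M → altSum tri N (suc M) i ≡ altSum tri N M i
  altSum-tri-extend N M zero _ N≤M = Σ<-drop-last (suc M) (λ k → (sign k * q ^ tri k) * (qbin q N k * 1ℚ))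
    (trans (cong (λ x → (sign (suc M) * q ^ tri (suc M)) * (x * 1ℚ)) (qbin-vanish q N (suc M) (s≤s N≤M)))
           (x*[0*y]≡0 (sign (suc M) * q ^ tri (suc M)) 1ℚ))
  altSum-tri-extend N M (suc p) p<N N≤M = begin
    altSum tri N (suc M) (suc p)   ≡⟨ Σ<-drop-last (suc M) υ υ-last ⟩
    Σ< (suc M) υ                   ≡⟨ x∙y⁻¹≈ε⇒x≈y (Σ< (suc M) υ) (altSum tri N M (suc p)) (begin
      Σ< (suc M) υ - altSum tri N M (suc p)   ≡⟨ altSum-tri-difference N M p ⟩
      q ^ (M ∸ p) * altSum choose₂ N M p      ≡⟨ cong (q ^ (M ∸ p) *_) (altSum-choose₂-vanish N M p p<N N≤M) ⟩
      q ^ (M ∸ p) * 0ℚ                        ≡⟨ ℚP.*-zeroʳ (q ^ (M ∸ p)) ⟩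
      0ℚ                                      ∎) ⟩
    altSum tri N M (suc p)         ∎
    where
    open ≡-Reasoning
    υ : ℕ → ℚ
    υ k = (sign k * q ^ tri k) * (qbin q N k * qbin q (suc M ∸ k) (suc p))
    υ-last : υ (suc M) ≡ 0ℚ
    υ-last = trans (cong (λ x → (sign (suc M) * q ^ tri (suc M)) * (x * qbin q (M ∸ M) (suc p))) (qbin-vanish q N (suc M) (s≤s N≤M)))
                   (x*[0*y]≡0 (sign (suc M) * q ^ tri (suc M)) (qbin q (M ∸ M) (suc p)))

  altSum-tri-stable : ∀ N e i → i ≤ N → altSum tri N (N +ℕ e) i ≡ altSum tri N N i
  altSum-tri-stable N zero i i≤N = cong (λ t → altSum tri N t i) (ℕP.+-identityʳ N)
  altSum-tri-stable N (suc e) i i≤N = trans (cong (λ t → altSum tri N t i) (ℕP.+-suc N e))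
    (trans (altSum-tri-extend N (N +ℕ e) i i≤N (ℕP.m≤m+n N e)) (altSum-tri-stable N e i i≤N))

  altSum-tri-diag : ∀ i → altSum tri i i i ≡ 1ℚ
  altSum-tri-diag i = begin
    altSum tri i i i
      ≡⟨ Σ<-head i _ ⟩
    (1ℚ * 1ℚ) * (1ℚ * qbin q i i) + Σ< i (λ k → (sign (suc k) * q ^ tri (suc k)) * (qbin q i (suc k) * qbin q (i ∸ suc k) i))
      ≡⟨ cong₂ (λ a b → (1ℚ * 1ℚ) * (1ℚ * a) + b) (qbin-diag q i) (Σ<-zero i tail≡0) ⟩
    1ℚ ∎
    where
    open ≡-Reasoning
    tail≡0 : ∀ k → k < i → (sign (suc k) * q ^ tri (suc k)) * (qbin q i (suc k) * qbin q (i ∸ suc k) i) ≡ 0ℚ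
    tail≡0 k k<i = trans (cong (λ x → (sign (suc k) * q ^ tri (suc k)) * (qbin q i (suc k) * x))
                               (qbin-vanish q (i ∸ suc k) i (ℕP.∸-monoʳ-< {o = 0} (s≤s z≤n) k<i)))
                         (x*[y*0]≡0 (sign (suc k) * q ^ tri (suc k)) (qbin q i (suc k)))

  altSum-tri-eval : ∀ i d M → i +ℕ d ≤ M → altSum tri (i +ℕ d) M i ≡ poch (q ^ suc i) q d
  altSum-tri-eval i zero M i+0≤M with ℕP.m≤n⇒∃[o]m+o≡n i+0≤M
  ... | e , refl = begin
    altSum tri (i +ℕ 0) (i +ℕ 0 +ℕ e) i   ≡⟨ cong (λ n → altSum tri n (n +ℕ e) i) (ℕP.+-identityʳ i) ⟩
    altSum tri i (i +ℕ e) i               ≡⟨ altSum-tri-stable i e i ℕP.≤-refl ⟩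
    altSum tri i i i                      ≡⟨ altSum-tri-diag i ⟩
    1ℚ                                    ∎
    where open ≡-Reasoning
  altSum-tri-eval i (suc d) M i+d<M with ℕP.m≤n⇒∃[o]m+o≡n (subst (_≤ M) (ℕP.+-suc i d) i+d<M)
  ... | e , refl = begin
    altSum tri (i +ℕ suc d) (suc (i +ℕ d) +ℕ e) i
      ≡⟨ cong (λ n → altSum tri n (suc (i +ℕ d) +ℕ e) i) (ℕP.+-suc i d) ⟩
    altSum tri (suc (i +ℕ d)) (suc (i +ℕ d +ℕ e)) i
      ≡⟨ altSum-tri-rec (i +ℕ d) (i +ℕ d +ℕ e) i ⟩
    altSum tri (i +ℕ d) (suc (i +ℕ d +ℕ e)) i - q ^ suc (i +ℕ d) * altSum tri (i +ℕ d) (i +ℕ d +ℕ e) i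
      ≡⟨ cong₂ (λ a b → a - q ^ suc (i +ℕ d) * b)
               (altSum-tri-eval i d _ (ℕP.m≤n⇒m≤1+n (ℕP.m≤m+n (i +ℕ d) e))) (altSum-tri-eval i d _ (ℕP.m≤m+n (i +ℕ d) e)) ⟩
    V - q ^ suc (i +ℕ d) * V
      ≡⟨ factor V (q ^ suc (i +ℕ d)) ⟩
    V * (1ℚ - q ^ suc (i +ℕ d))
      ≡⟨ cong (λ x → V * (1ℚ - x)) (^-distribˡ-+-* q (suc i) d) ⟩
    V * (1ℚ - q ^ suc i * q ^ d)
      ∎
    where
    open ≡-Reasoning
    V = poch (q ^ suc i) q d
    factor : ∀ V a → V - a * V ≡ V * (1ℚ - a)
    factor = solve-∀ ℚ-ring

Tℕ-exponent : ∀ i K e r → i ℤ.+ + suc K ≡ + e → r ≤ K → Tℕ (i ℤ.+ + suc r) +ℕ (K ∸ r) ≡ Tℕ (i ℤ.+ + r) +ℕ e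
Tℕ-exponent i K e r i+K+1≡e r≤K = ℤP.+-injective (begin
  + (Tℕ (i ℤ.+ + suc r) +ℕ (K ∸ r))          ≡⟨ ℤP.pos-+ (Tℕ (i ℤ.+ + suc r)) (K ∸ r) ⟩
  + Tℕ (i ℤ.+ + suc r) ℤ.+ + (K ∸ r)         ≡⟨ cong₂ ℤ._+_ (cong (λ t → + Tℕ t) i+r+1) (+[m∸n]≡+m-+n r≤K) ⟩
  + Tℕ (y ℤ.+ + 1) ℤ.+ (+ K ℤ.- + r)         ≡⟨ cong (ℤ._+ (+ K ℤ.- + r)) (Tℕ-suc y) ⟩
  + Tℕ y ℤ.+ (y ℤ.+ + 1) ℤ.+ (+ K ℤ.- + r)   ≡⟨ regroup (+ Tℕ y) i (+ r) (+ K) ⟩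
  + Tℕ y ℤ.+ (i ℤ.+ + suc K)                 ≡⟨ cong (λ x → + Tℕ y ℤ.+ x) i+K+1≡e ⟩
  + Tℕ y ℤ.+ + e                             ≡⟨ ℤP.pos-+ (Tℕ y) e ⟨
  + (Tℕ y +ℕ e)                              ∎)
  where
  open ≡-Reasoning
  y = i ℤ.+ + r
  i+r+1 : i ℤ.+ + suc r ≡ y ℤ.+ + 1
  i+r+1 = trans (cong (λ x → i ℤ.+ x) (cong +_ (ℕP.+-comm 1 r))) (sym (ℤP.+-assoc i (+ r) (+ 1)))
  regroup : ∀ T i r K → T ℤ.+ (i ℤ.+ r ℤ.+ + 1) ℤ.+ (K ℤ.- r) ≡ T ℤ.+ (i ℤ.+ (+ 1 ℤ.+ K))
  regroup = ℤSolver.solve-∀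

module _ (q : ℚ) where

  rothe : ℤ → ℕ → ℚ
  rothe i K = Σ< (suc K) (λ r → (sign r * q ^ Tℕ (i ℤ.+ + r)) * qbin q K r)

  rothe-rec : ∀ i K e → i ℤ.+ + suc K ≡ + e → rothe i (suc K) ≡ (1ℚ - q ^ e) * rothe i K
  rothe-rec i K e i+K+1≡e = begin
    rothe i (suc K)                                   ≡⟨ Σ<-pascal (suc K) _ υ ω refl step ⟩
    Σ< (suc (suc K)) υ - Σ< (suc K) ω                 ≡⟨ cong₂ _-_ (Σ<-drop-last (suc K) υ υ-last) (Σ<-*ˡ (suc K) (q ^ e) υ) ⟩
    rothe i K - q ^ e * rothe i K                     ≡⟨ factor (rothe i K) (q ^ e) ⟩
    (1ℚ - q ^ e) * rothe i K                          ∎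
    where
    open ≡-Reasoning
    υ ω : ℕ → ℚ
    υ r = (sign r * q ^ Tℕ (i ℤ.+ + r)) * qbin q K r
    ω r = q ^ e * υ r
    factor : ∀ Y a → Y - a * Y ≡ (1ℚ - a) * Y
    factor = solve-∀ ℚ-ring
    υ-last : υ (suc K) ≡ 0ℚ
    υ-last = trans (cong ((sign (suc K) * q ^ Tℕ (i ℤ.+ + suc K)) *_) (qbin-vanish q K (suc K) ℕP.≤-refl))
                   (ℚP.*-zeroʳ (sign (suc K) * q ^ Tℕ (i ℤ.+ + suc K)))
    expand : ∀ s t a A B → ((- 1ℚ) * s * t) * (a * A + B) ≡ ((- 1ℚ) * s * (t * a)) * A + ((- 1ℚ) * s * t) * B
    expand = solve-∀ ℚ-ring
    regroup : ∀ s t u X → ((- 1ℚ) * s * (t * u)) * X ≡ - (u * ((s * t) * X))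
    regroup = solve-∀ ℚ-ring
    step : ∀ r → r < suc K → (sign (suc r) * q ^ Tℕ (i ℤ.+ + suc r)) * qbin q (suc K) (suc r) ≡ - ω r + υ (suc r)
    step r (s≤s r≤K) = begin
      (sign (suc r) * q ^ Tℕ (i ℤ.+ + suc r)) * qbin q (suc K) (suc r)
        ≡⟨ cong ((sign (suc r) * q ^ Tℕ (i ℤ.+ + suc r)) *_) (qbin-pascal′ q K r) ⟩
      (sign (suc r) * q ^ Tℕ (i ℤ.+ + suc r)) * (q ^ (K ∸ r) * qbin q K r + qbin q K (suc r))
        ≡⟨ expand (sign r) (q ^ Tℕ (i ℤ.+ + suc r)) (q ^ (K ∸ r)) (qbin q K r) (qbin q K (suc r)) ⟩
      ((- 1ℚ) * sign r * (q ^ Tℕ (i ℤ.+ + suc r) * q ^ (K ∸ r))) * qbin q K r + υ (suc r)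
        ≡⟨ cong (λ x → ((- 1ℚ) * sign r * x) * qbin q K r + υ (suc r))
                (^-exponents q (Tℕ (i ℤ.+ + suc r)) (K ∸ r) (Tℕ (i ℤ.+ + r)) e (Tℕ-exponent i K e r i+K+1≡e r≤K)) ⟩
      ((- 1ℚ) * sign r * (q ^ Tℕ (i ℤ.+ + r) * q ^ e)) * qbin q K r + υ (suc r)
        ≡⟨ cong (_+ υ (suc r)) (regroup (sign r) (q ^ Tℕ (i ℤ.+ + r)) (q ^ e) (qbin q K r)) ⟩
      - ω r + υ (suc r) ∎

  rothe-nonneg : ∀ a K → rothe (+ a) K ≡ q ^ tri a * poch (q ^ suc a) q K
  rothe-nonneg a zero = begin
    0ℚ + (1ℚ * q ^ tri (a +ℕ 0)) * 1ℚ   ≡⟨ cong (λ t → 0ℚ + (1ℚ * q ^ tri t) * 1ℚ) (ℕP.+-identityʳ a) ⟩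
    0ℚ + (1ℚ * q ^ tri a) * 1ℚ          ≡⟨ simplify (q ^ tri a) ⟩
    q ^ tri a * 1ℚ                      ∎
    where
    open ≡-Reasoning
    simplify : ∀ x → 0ℚ + (1ℚ * x) * 1ℚ ≡ x * 1ℚ
    simplify = solve-∀ ℚ-ring
  rothe-nonneg a (suc K) = begin
    rothe (+ a) (suc K)                              ≡⟨ rothe-rec (+ a) K (a +ℕ suc K) refl ⟩
    (1ℚ - q ^ (a +ℕ suc K)) * rothe (+ a) K          ≡⟨ cong₂ (λ x y → (1ℚ - x) * y) exponent (rothe-nonneg a K) ⟩
    (1ℚ - q ^ suc a * q ^ K) * (q ^ tri a * V)       ≡⟨ regroup (q ^ suc a * q ^ K) (q ^ tri a) V ⟩
    q ^ tri a * (V * (1ℚ - q ^ suc a * q ^ K))       ∎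
    where
    open ≡-Reasoning
    V = poch (q ^ suc a) q K
    exponent : q ^ (a +ℕ suc K) ≡ q ^ suc a * q ^ K
    exponent = trans (cong (q ^_) (ℕP.+-suc a K)) (^-distribˡ-+-* q (suc a) K)
    regroup : ∀ u t V → (1ℚ - u) * (t * V) ≡ t * (V * (1ℚ - u))
    regroup = solve-∀ ℚ-ring

  rothe-neg : ∀ s K → s < K → rothe -[1+ s ] K ≡ 0ℚ
  rothe-neg s (suc K) (s≤s s≤K) with ℕP.m≤n⇒m<n∨m≡n s≤K
  ... | inj₂ refl = begin
    rothe -[1+ s ] (suc s)                    ≡⟨ rothe-rec -[1+ s ] s (s ∸ s) (-[1+m]+[1+n]≡n∸m s≤K) ⟩
    (1ℚ - q ^ (s ∸ s)) * rothe -[1+ s ] s     ≡⟨ cong (λ e → (1ℚ - q ^ e) * rothe -[1+ s ] s) (ℕP.n∸n≡0 s) ⟩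
    0ℚ * rothe -[1+ s ] s                     ≡⟨ ℚP.*-zeroˡ (rothe -[1+ s ] s) ⟩
    0ℚ                                        ∎
    where open ≡-Reasoning
  ... | inj₁ s<K = begin
    rothe -[1+ s ] (suc K)                    ≡⟨ rothe-rec -[1+ s ] K (K ∸ s) (-[1+m]+[1+n]≡n∸m s≤K) ⟩
    (1ℚ - q ^ (K ∸ s)) * rothe -[1+ s ] K     ≡⟨ cong ((1ℚ - q ^ (K ∸ s)) *_) (rothe-neg s K s<K) ⟩
    (1ℚ - q ^ (K ∸ s)) * 0ℚ                   ≡⟨ ℚP.*-zeroʳ (1ℚ - q ^ (K ∸ s)) ⟩
    0ℚ                                        ∎
    where open ≡-Reasoning

poch-≢0 : ∀ a q n → (∀ t → t < n → 1ℚ - a * q ^ t ≢ 0ℚ) → poch a q n ≢ 0ℚ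
poch-≢0 a q zero factors≢0 ()
poch-≢0 a q (suc n) factors≢0 =
  *-≢0 (poch-≢0 a q n (λ t t<n → factors≢0 t (ℕP.m<n⇒m<1+n t<n))) (factors≢0 n ℕP.≤-refl)

ratio-step-algebra : ∀ X G H p u t c → X ≡ p * G + H → X ≡ G + u * H →
                     (1ℚ - c * (t * p)) * X - (1ℚ - c * (u * (t * p))) * H ≡ p * G * (1ℚ - c * t)
ratio-step-algebra X G H p u t c pascal′ pascal = begin
  (1ℚ - c * (t * p)) * X - (1ℚ - c * (u * (t * p))) * H   ≡⟨ split X H u t p c ⟩
  (X - H) - c * (t * p) * (X - u * H)                      ≡⟨ cong₂ (λ a b → (a - H) - c * (t * p) * (b - u * H)) pascal′ pascal ⟩
  (p * G + H - H) - c * (t * p) * (G + u * H - u * H)      ≡⟨ simplify p G H u t c ⟩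
  p * G * (1ℚ - c * t)                                     ∎
  where
  open ≡-Reasoning
  split : ∀ X H u t p c → (1ℚ - c * (t * p)) * X - (1ℚ - c * (u * (t * p))) * H ≡ (X - H) - c * (t * p) * (X - u * H)
  split = solve-∀ ℚ-ring
  simplify : ∀ p G H u t c → (p * G + H - H) - c * (t * p) * (G + u * H - u * H) ≡ p * G * (1ℚ - c * t)
  simplify = solve-∀ ℚ-ring

module _ (q : ℚ) where

  binomialPair : ℕ → ℕ → ℕ → ℚ
  binomialPair a b j = qbin q a j * qbin q (a +ℕ b ∸ j) a

  binomialPair-vanish : ∀ a b j → a < j ⊎ b < j → binomialPair a b j ≡ 0ℚ
  binomialPair-vanish a b j (inj₁ a<j) =
    trans (cong (_* qbin q (a +ℕ b ∸ j) a) (qbin-vanish q a j a<j)) (ℚP.*-zeroˡ (qbin q (a +ℕ b ∸ j) a))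
  binomialPair-vanish a b j (inj₂ b<j) with a ℕP.<? j
  ... | yes a<j = binomialPair-vanish a b j (inj₁ a<j)
  ... | no a≮j = trans (cong (qbin q a j *_) (qbin-vanish q (a +ℕ b ∸ j) a a+b∸j<a)) (ℚP.*-zeroʳ (qbin q a j))
    where
    j≤a : j ≤ a
    j≤a = ℕP.≮⇒≥ a≮j
    a+b∸j<a : a +ℕ b ∸ j < a
    a+b∸j<a = subst (a +ℕ b ∸ j <_) (ℕP.m+n∸n≡m a j)
                (ℕP.∸-monoˡ-< (ℕP.+-monoʳ-< a b<j) (ℕP.≤-trans j≤a (ℕP.m≤m+n a b)))

module _ (q c : ℚ) where

  cPoch : ℕ → ℚ
  cPoch n = poch (c * q) q n

  cFactor : ℕ → ℚ
  cFactor j = (1ℚ - c) * inv (1ℚ - c * q ^ j)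

  weight : ℕ → ℚ
  weight j = (sign j * q ^ tri j) * cFactor j

  ratioSum : ℕ → ℕ → ℚ
  ratioSum a b = Σ< (suc a) (λ j → weight j * binomialPair q a b j)

  cFactor-cancel : ∀ j → 1ℚ - c * q ^ j ≢ 0ℚ → cFactor j * (1ℚ - c * q ^ j) ≡ 1ℚ - c
  cFactor-cancel j ≢0 = trans (ℚP.*-assoc (1ℚ - c) _ _)
    (trans (cong ((1ℚ - c) *_) (inv-inverseˡ _ ≢0)) (ℚP.*-identityʳ (1ℚ - c)))

  cFactor-zero : 1ℚ - c * 1ℚ ≢ 0ℚ → cFactor 0 ≡ 1ℚ
  cFactor-zero ≢0 = trans (cong (_* inv (1ℚ - c * 1ℚ)) (cong (λ x → 1ℚ - x) (sym (ℚP.*-identityʳ c)))) (inv-inverseʳ _ ≢0)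

  cPoch-suc : ∀ n → cPoch (suc n) ≡ cPoch n * (1ℚ - c * q ^ suc n)
  cPoch-suc n = cong (λ x → cPoch n * (1ℚ - x)) (ℚP.*-assoc c q (q ^ n))

  ratioSum-step-term : ∀ a′ b j → j ≤ suc a′ → 1ℚ - c * q ^ j ≢ 0ℚ →
    (1ℚ - c * q ^ suc b) * (weight j * binomialPair q (suc a′) (suc b) j)
      - (1ℚ - c * q ^ suc (suc a′ +ℕ b)) * (weight j * binomialPair q (suc a′) b j)
    ≡ ((1ℚ - c) * q ^ suc b) * ((sign j * q ^ choose₂ j) * (qbin q (suc a′) j * qbin q (suc a′ +ℕ b ∸ j) a′))
  ratioSum-step-term a′ b j j≤a cq^j≢1 = subst Goal (sym pair-suc) (case (j ℕP.≤? suc b))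
    where
    a = suc a′
    n = a +ℕ b ∸ j
    X = qbin q (suc n) a
    G = qbin q n a′
    H = qbin q n a
    Qa = qbin q a j
    Goal : ℚ → Set
    Goal E = (1ℚ - c * q ^ suc b) * (weight j * E) - (1ℚ - c * q ^ suc (a +ℕ b)) * (weight j * (Qa * H))
             ≡ ((1ℚ - c) * q ^ suc b) * ((sign j * q ^ choose₂ j) * (Qa * G))
    pair-suc : binomialPair q a (suc b) j ≡ Qa * X
    pair-suc = cong (λ t → Qa * qbin q t a)
                    (trans (cong (_∸ j) (ℕP.+-suc a b)) (ℕP.+-∸-assoc 1 (ℕP.≤-trans j≤a (ℕP.m≤m+n a b))))
    open ≡-Reasoning
    case : Dec (j ≤ suc b) → Goal (Qa * X)
    case (yes j≤b+1) with ℕP.m≤n⇒∃[o]m+o≡n j≤b+1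
    ... | e , j+e≡b+1 = begin
      (1ℚ - c * q ^ suc b) * (weight j * (Qa * X)) - (1ℚ - c * q ^ suc (a +ℕ b)) * (weight j * (Qa * H))
        ≡⟨ cong₂ (λ x y → (1ℚ - c * x) * (weight j * (Qa * X)) - (1ℚ - c * y) * (weight j * (Qa * H))) q^[b+1] q^[a+b+1] ⟩
      (1ℚ - c * (t * p)) * (weight j * (Qa * X)) - (1ℚ - c * (u * (t * p))) * (weight j * (Qa * H))
        ≡⟨ factor-out (weight j) Qa X H c t p u ⟩
      weight j * Qa * ((1ℚ - c * (t * p)) * X - (1ℚ - c * (u * (t * p))) * H)
        ≡⟨ cong (weight j * Qa *_) (ratio-step-algebra X G H p u t c X≡pG+H refl) ⟩
      weight j * Qa * (p * G * (1ℚ - c * t))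
        ≡⟨ regroup (sign j) (q ^ tri j) (cFactor j) Qa p G (1ℚ - c * t) ⟩
      (sign j * (q ^ tri j * p)) * (cFactor j * (1ℚ - c * t)) * (Qa * G)
        ≡⟨ cong₂ (λ x y → (sign j * x) * y * (Qa * G)) q^tri[j]*p (cFactor-cancel j cq^j≢1) ⟩
      (sign j * (q ^ choose₂ j * q ^ suc b)) * (1ℚ - c) * (Qa * G)
        ≡⟨ regroup′ (sign j) (q ^ choose₂ j) (q ^ suc b) (1ℚ - c) (Qa * G) ⟩
      ((1ℚ - c) * q ^ suc b) * ((sign j * q ^ choose₂ j) * (Qa * G)) ∎
      where
      t = q ^ j
      p = q ^ e
      u = q ^ a
      q^[b+1] : q ^ suc b ≡ t * p
      q^[b+1] = trans (cong (q ^_) (sym j+e≡b+1)) (^-distribˡ-+-* q j e)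
      q^[a+b+1] : q ^ suc (a +ℕ b) ≡ u * (t * p)
      q^[a+b+1] = trans (cong (q ^_) (sym (ℕP.+-suc a b))) (trans (^-distribˡ-+-* q a (suc b)) (cong (u *_) q^[b+1]))
      n≡a′+e : n ≡ a′ +ℕ e
      n≡a′+e = begin
        (suc a′ +ℕ b) ∸ j       ≡⟨ cong (_∸ j) (sym (ℕP.+-suc a′ b)) ⟩
        a′ +ℕ suc b ∸ j         ≡⟨ cong (λ x → a′ +ℕ x ∸ j) (trans (sym j+e≡b+1) (ℕP.+-comm j e)) ⟩
        a′ +ℕ (e +ℕ j) ∸ j      ≡⟨ cong (_∸ j) (sym (ℕP.+-assoc a′ e j)) ⟩
        a′ +ℕ e +ℕ j ∸ j        ≡⟨ ℕP.m+n∸n≡m (a′ +ℕ e) j ⟩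
        a′ +ℕ e                 ∎
      n∸a′≡e : n ∸ a′ ≡ e
      n∸a′≡e = trans (cong (_∸ a′) n≡a′+e) (ℕP.m+n∸m≡n a′ e)
      X≡pG+H : X ≡ p * G + H
      X≡pG+H = trans (qbin-pascal′ q n a′) (cong (λ x → q ^ x * G + H) n∸a′≡e)
      q^tri[j]*p : q ^ tri j * p ≡ q ^ choose₂ j * q ^ suc b
      q^tri[j]*p = ^-exponents q (tri j) e (choose₂ j) (suc b)
        (trans (cong (_+ℕ e) (tri≡choose₂+n j)) (trans (ℕP.+-assoc (choose₂ j) j e) (cong (choose₂ j +ℕ_) j+e≡b+1)))
      factor-out : ∀ w Qa X H c t p u → (1ℚ - c * (t * p)) * (w * (Qa * X)) - (1ℚ - c * (u * (t * p))) * (w * (Qa * H))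
                                        ≡ w * Qa * ((1ℚ - c * (t * p)) * X - (1ℚ - c * (u * (t * p))) * H)
      factor-out = solve-∀ ℚ-ring
      regroup : ∀ s x d Qa p G y → (s * x) * d * Qa * (p * G * y) ≡ (s * (x * p)) * (d * y) * (Qa * G)
      regroup = solve-∀ ℚ-ring
      regroup′ : ∀ s x y z w → (s * (x * y)) * z * w ≡ (z * y) * ((s * x) * w)
      regroup′ = solve-∀ ℚ-ring
    case (no j≰b+1) = begin
      (1ℚ - c * q ^ suc b) * (weight j * (Qa * X)) - (1ℚ - c * q ^ suc (a +ℕ b)) * (weight j * (Qa * H))
        ≡⟨ cong₂ (λ x y → (1ℚ - c * q ^ suc b) * (weight j * (Qa * x)) - (1ℚ - c * q ^ suc (a +ℕ b)) * (weight j * (Qa * y)))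
                 (qbin-vanish q (suc n) a (s≤s n<a′)) (qbin-vanish q n a (ℕP.m<n⇒m<1+n n<a′)) ⟩
      (1ℚ - c * q ^ suc b) * (weight j * (Qa * 0ℚ)) - (1ℚ - c * q ^ suc (a +ℕ b)) * (weight j * (Qa * 0ℚ))
        ≡⟨ zeros (1ℚ - c * q ^ suc b) (1ℚ - c * q ^ suc (a +ℕ b)) (weight j) Qa ((1ℚ - c) * q ^ suc b) (sign j * q ^ choose₂ j) ⟩
      ((1ℚ - c) * q ^ suc b) * ((sign j * q ^ choose₂ j) * (Qa * 0ℚ))
        ≡⟨ cong (λ x → ((1ℚ - c) * q ^ suc b) * ((sign j * q ^ choose₂ j) * (Qa * x))) (qbin-vanish q n a′ n<a′) ⟨
      ((1ℚ - c) * q ^ suc b) * ((sign j * q ^ choose₂ j) * (Qa * G)) ∎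
      where
      n<a′ : n < a′
      n<a′ = subst₂ _<_ (cong (_∸ j) (ℕP.+-suc a′ b)) (ℕP.m+n∸n≡m a′ j)
               (ℕP.∸-monoˡ-< (ℕP.+-monoʳ-< a′ (ℕP.≰⇒> j≰b+1))
                             (ℕP.≤-trans j≤a (ℕP.≤-trans (s≤s (ℕP.m≤m+n a′ b)) (ℕP.≤-reflexive (sym (ℕP.+-suc a′ b))))))
      zeros : ∀ A B w Qa z m → A * (w * (Qa * 0ℚ)) - B * (w * (Qa * 0ℚ)) ≡ z * (m * (Qa * 0ℚ))
      zeros = solve-∀ ℚ-ring

  -- After the two normalising factors, the sums differ by (1 - c) q^(b+1) times a vanishing alternating sum.
  ratioSum-rec : ∀ a′ b → (∀ j → j ≤ suc a′ → 1ℚ - c * q ^ j ≢ 0ℚ) →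
    (1ℚ - c * q ^ suc b) * ratioSum (suc a′) (suc b) ≡ (1ℚ - c * q ^ suc (suc a′ +ℕ b)) * ratioSum (suc a′) b
  ratioSum-rec a′ b cq^j≢1 = x∙y⁻¹≈ε⇒x≈y _ _ (begin
    α * ratioSum a (suc b) - β * ratioSum a b
      ≡⟨ cong₂ _-_ (Σ<-*ˡ (suc a) α _) (Σ<-*ˡ (suc a) β _) ⟨
    Σ< (suc a) (λ j → α * (weight j * binomialPair q a (suc b) j)) - Σ< (suc a) (λ j → β * (weight j * binomialPair q a b j))
      ≡⟨ Σ<-- (suc a) _ _ ⟨
    Σ< (suc a) (λ j → α * (weight j * binomialPair q a (suc b) j) - β * (weight j * binomialPair q a b j))
      ≡⟨ Σ<-cong (suc a) (λ j j≤a → ratioSum-step-term a′ b j (ℕP.≤-pred j≤a) (cq^j≢1 j (ℕP.≤-pred j≤a))) ⟩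
    Σ< (suc a) (λ j → γ * term j)
      ≡⟨ Σ<-*ˡ (suc a) γ term ⟩
    γ * Σ< (suc a) term
      ≡⟨ cong (γ *_) (Σ<-tail-zero term (s≤s (ℕP.m≤m+n a b)) beyond-a) ⟨
    γ * altSum q choose₂ a (a +ℕ b) a′
      ≡⟨ cong (γ *_) (altSum-choose₂-vanish q a (a +ℕ b) a′ ℕP.≤-refl (ℕP.m≤m+n a b)) ⟩
    γ * 0ℚ
      ≡⟨ ℚP.*-zeroʳ γ ⟩
    0ℚ ∎)
    where
    open ≡-Reasoning
    a = suc a′
    α = 1ℚ - c * q ^ suc b
    β = 1ℚ - c * q ^ suc (a +ℕ b)
    γ = (1ℚ - c) * q ^ suc b
    term : ℕ → ℚ
    term j = (sign j * q ^ choose₂ j) * (qbin q a j * qbin q (a +ℕ b ∸ j) a′)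
    beyond-a : ∀ k → suc a ≤ k → k < suc (a +ℕ b) → term k ≡ 0ℚ
    beyond-a k a<k _ = trans (cong (λ x → (sign k * q ^ choose₂ k) * (x * qbin q (a +ℕ b ∸ k) a′)) (qbin-vanish q a k a<k))
                             (x*[0*y]≡0 (sign k * q ^ choose₂ k) (qbin q (a +ℕ b ∸ k) a′))

  ratioSum-zeroʳ : ∀ a → 1ℚ - c * 1ℚ ≢ 0ℚ → ratioSum a 0 ≡ 1ℚ
  ratioSum-zeroʳ a c≢1 = begin
    ratioSum a 0
      ≡⟨ Σ<-head a _ ⟩
    ((1ℚ * 1ℚ) * cFactor 0) * (1ℚ * qbin q (a +ℕ 0) a) + Σ< a (λ k → weight (suc k) * binomialPair q a 0 (suc k))
      ≡⟨ cong₂ (λ x y → ((1ℚ * 1ℚ) * x) * (1ℚ * y) + Σ< a (λ k → weight (suc k) * binomialPair q a 0 (suc k)))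
               (cFactor-zero c≢1) (trans (cong (λ t → qbin q t a) (ℕP.+-identityʳ a)) (qbin-diag q a)) ⟩
    1ℚ + Σ< a (λ k → weight (suc k) * binomialPair q a 0 (suc k))
      ≡⟨ cong (λ x → 1ℚ + x) (Σ<-zero a tail≡0) ⟩
    1ℚ ∎
    where
    open ≡-Reasoning
    tail≡0 : ∀ k → k < a → weight (suc k) * binomialPair q a 0 (suc k) ≡ 0ℚ
    tail≡0 k k<a = trans (cong (λ x → weight (suc k) * (qbin q a (suc k) * x))
                               (qbin-vanish q (a +ℕ 0 ∸ suc k) a
                                 (subst (λ t → t ∸ suc k < a) (sym (ℕP.+-identityʳ a)) (ℕP.∸-monoʳ-< {o = 0} (s≤s z≤n) k<a))))
                         (x*[y*0]≡0 (weight (suc k)) (qbin q a (suc k)))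

  cPoch*cPoch*ratioSum : ∀ a b → (∀ j → j ≤ a → 1ℚ - c * q ^ j ≢ 0ℚ) → cPoch a * cPoch b * ratioSum a b ≡ cPoch (a +ℕ b)
  cPoch*cPoch*ratioSum zero b cq^j≢1 = begin
    1ℚ * cPoch b * (0ℚ + ((1ℚ * 1ℚ) * cFactor 0) * (1ℚ * 1ℚ))
      ≡⟨ cong (λ x → 1ℚ * cPoch b * (0ℚ + ((1ℚ * 1ℚ) * x) * (1ℚ * 1ℚ))) (cFactor-zero (cq^j≢1 0 z≤n)) ⟩
    1ℚ * cPoch b * 1ℚ                                          ≡⟨ trans (ℚP.*-identityʳ _) (ℚP.*-identityˡ (cPoch b)) ⟩
    cPoch b                                                    ∎
    where open ≡-Reasoning
  cPoch*cPoch*ratioSum (suc a′) zero cq^j≢1 = begin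
    cPoch a * 1ℚ * ratioSum a 0   ≡⟨ cong (cPoch a * 1ℚ *_) (ratioSum-zeroʳ a (cq^j≢1 0 z≤n)) ⟩
    cPoch a * 1ℚ * 1ℚ             ≡⟨ trans (ℚP.*-identityʳ _) (ℚP.*-identityʳ (cPoch a)) ⟩
    cPoch a                       ≡⟨ cong cPoch (ℕP.+-identityʳ a) ⟨
    cPoch (a +ℕ 0)                ∎
    where
    open ≡-Reasoning
    a = suc a′
  cPoch*cPoch*ratioSum (suc a′) (suc b) cq^j≢1 = begin
    cPoch a * cPoch (suc b) * ratioSum a (suc b)                    ≡⟨ cong (λ x → cPoch a * x * ratioSum a (suc b)) (cPoch-suc b) ⟩
    cPoch a * (cPoch b * (1ℚ - c * q ^ suc b)) * ratioSum a (suc b) ≡⟨ regroup (cPoch a) (cPoch b) (1ℚ - c * q ^ suc b) (ratioSum a (suc b)) ⟩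
    cPoch a * cPoch b * ((1ℚ - c * q ^ suc b) * ratioSum a (suc b)) ≡⟨ cong (cPoch a * cPoch b *_) (ratioSum-rec a′ b cq^j≢1) ⟩
    cPoch a * cPoch b * ((1ℚ - c * q ^ suc (a +ℕ b)) * ratioSum a b) ≡⟨ regroup′ (cPoch a) (cPoch b) (1ℚ - c * q ^ suc (a +ℕ b)) (ratioSum a b) ⟩
    (cPoch a * cPoch b * ratioSum a b) * (1ℚ - c * q ^ suc (a +ℕ b)) ≡⟨ cong (_* (1ℚ - c * q ^ suc (a +ℕ b))) (cPoch*cPoch*ratioSum a b cq^j≢1) ⟩
    cPoch (a +ℕ b) * (1ℚ - c * q ^ suc (a +ℕ b))                    ≡⟨ cPoch-suc (a +ℕ b) ⟨
    cPoch (suc (a +ℕ b))                                            ≡⟨ cong cPoch (ℕP.+-suc a b) ⟨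
    cPoch (a +ℕ suc b)                                              ∎
    where
    open ≡-Reasoning
    a = suc a′
    regroup : ∀ x y z w → x * (y * z) * w ≡ x * y * (z * w)
    regroup = solve-∀ ℚ-ring
    regroup′ : ∀ x y z w → x * y * (z * w) ≡ (x * y * w) * z
    regroup′ = solve-∀ ℚ-ring

  cPoch-≢0 : ∀ {n N} → n ≤ N → (∀ j → j ≤ N → 1ℚ - c * q ^ j ≢ 0ℚ) → cPoch n ≢ 0ℚ
  cPoch-≢0 n≤N cq^j≢1 = poch-≢0 (c * q) q _
    (λ t t<n ≡0 → cq^j≢1 (suc t) (ℕP.≤-trans t<n n≤N) (trans (cong (λ x → 1ℚ - x) (sym (ℚP.*-assoc c q (q ^ t)))) ≡0))

  cPoch-ratio : ∀ a b → (∀ j → j ≤ a +ℕ b → 1ℚ - c * q ^ j ≢ 0ℚ) → cPoch (a +ℕ b) * inv (cPoch a * cPoch b) ≡ ratioSum a b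
  cPoch-ratio a b cq^j≢1 = x≡y*d⇒x*inv[d]≡y
    (*-≢0 (cPoch-≢0 (ℕP.m≤m+n a b) cq^j≢1) (cPoch-≢0 (ℕP.m≤n+m b a) cq^j≢1))
    (trans (sym (cPoch*cPoch*ratioSum a b (λ j j≤a → cq^j≢1 j (ℕP.≤-trans j≤a (ℕP.m≤m+n a b)))))
           (ℚP.*-comm (cPoch a * cPoch b) (ratioSum a b)))

module _ (q : ℚ) where

  pairTerm : ℤ → ℕ → ℕ → ℕ → ℚ
  pairTerm m S j t = (sign t * q ^ Tℕ (m ℤ.+ + t)) * binomialPair q (S ∸ t) t j

  pairSum : ℤ → ℕ → ℕ → ℚ
  pairSum m S j = Σ< (suc S) (pairTerm m S j)

  pairTerm-vanish : ∀ m S j t → S ∸ t < j ⊎ t < j → pairTerm m S j t ≡ 0ℚ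
  pairTerm-vanish m S j t small = trans (cong ((sign t * q ^ Tℕ (m ℤ.+ + t)) *_) (binomialPair-vanish q (S ∸ t) t j small))
                                        (ℚP.*-zeroʳ (sign t * q ^ Tℕ (m ℤ.+ + t)))

  -- The trinomial revision turns [K+j-r, j] [K+j, K+j-r] into [K+j, j] [K, r].
  pairTerm-revision : ∀ m j K r → r ≤ K → pairTerm m (K +ℕ (j +ℕ j)) j (j +ℕ r)
                      ≡ sign j * qbin q (K +ℕ j) j * ((sign r * q ^ Tℕ (m ℤ.+ + j ℤ.+ + r)) * qbin q K r)
  pairTerm-revision m j K r r≤K = begin
    (sign (j +ℕ r) * q ^ Tℕ (m ℤ.+ + (j +ℕ r))) * (qbin q (S ∸ (j +ℕ r)) j * qbin q (S ∸ (j +ℕ r) +ℕ (j +ℕ r) ∸ j) (S ∸ (j +ℕ r)))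
      ≡⟨ cong (λ a → (sign (j +ℕ r) * q ^ Tℕ (m ℤ.+ + (j +ℕ r))) * (qbin q a j * qbin q (a +ℕ (j +ℕ r) ∸ j) a)) S∸[j+r]≡j+y ⟩
    (sign (j +ℕ r) * q ^ Tℕ (m ℤ.+ + (j +ℕ r))) * (qbin q (j +ℕ y) j * qbin q (j +ℕ y +ℕ (j +ℕ r) ∸ j) (j +ℕ y))
      ≡⟨ cong (λ n → (sign (j +ℕ r) * q ^ Tℕ (m ℤ.+ + (j +ℕ r))) * (qbin q (j +ℕ y) j * qbin q n (j +ℕ y))) top ⟩
    (sign (j +ℕ r) * q ^ Tℕ (m ℤ.+ + (j +ℕ r))) * (qbin q (j +ℕ y) j * qbin q (j +ℕ y +ℕ r) (j +ℕ y))
      ≡⟨ cong ((sign (j +ℕ r) * q ^ Tℕ (m ℤ.+ + (j +ℕ r))) *_)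
              (trans (ℚP.*-comm (qbin q (j +ℕ y) j) _) (qbin-trinomial q j y r)) ⟩
    (sign (j +ℕ r) * q ^ Tℕ (m ℤ.+ + (j +ℕ r))) * (qbin q (j +ℕ (y +ℕ r)) j * qbin q (r +ℕ y) r)
      ≡⟨ cong₂ (λ a b → (sign (j +ℕ r) * q ^ Tℕ (m ℤ.+ + (j +ℕ r))) * (qbin q a j * qbin q b r)) j+[y+r]≡K+j r+y≡K ⟩
    (sign (j +ℕ r) * q ^ Tℕ (m ℤ.+ + (j +ℕ r))) * (qbin q (K +ℕ j) j * qbin q K r)
      ≡⟨ cong₂ (λ s e → (s * q ^ Tℕ e) * (qbin q (K +ℕ j) j * qbin q K r))
               (^-distribˡ-+-* (- 1ℚ) j r) (sym (ℤP.+-assoc m (+ j) (+ r))) ⟩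
    (sign j * sign r * q ^ Tℕ (m ℤ.+ + j ℤ.+ + r)) * (qbin q (K +ℕ j) j * qbin q K r)
      ≡⟨ regroup (sign j) (sign r) (q ^ Tℕ (m ℤ.+ + j ℤ.+ + r)) (qbin q (K +ℕ j) j) (qbin q K r) ⟩
    sign j * qbin q (K +ℕ j) j * ((sign r * q ^ Tℕ (m ℤ.+ + j ℤ.+ + r)) * qbin q K r) ∎
    where
    open ≡-Reasoning
    S = K +ℕ (j +ℕ j)
    y = K ∸ r
    r+y≡K : r +ℕ y ≡ K
    r+y≡K = ℕP.m+[n∸m]≡n r≤K
    S∸[j+r]≡j+y : S ∸ (j +ℕ r) ≡ j +ℕ y
    S∸[j+r]≡j+y = trans (cong (λ k → k +ℕ (j +ℕ j) ∸ (j +ℕ r)) (sym r+y≡K))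
                        (trans (cong (_∸ (j +ℕ r)) (shuffle r y j)) (ℕP.m+n∸m≡n (j +ℕ r) (j +ℕ y)))
      where
      shuffle : ∀ r y j → r +ℕ y +ℕ (j +ℕ j) ≡ j +ℕ r +ℕ (j +ℕ y)
      shuffle = ℕSolver.solve-∀
    top : j +ℕ y +ℕ (j +ℕ r) ∸ j ≡ j +ℕ y +ℕ r
    top = trans (cong (_∸ j) (shuffle j y r)) (ℕP.m+n∸n≡m (j +ℕ y +ℕ r) j)
      where
      shuffle : ∀ j y r → j +ℕ y +ℕ (j +ℕ r) ≡ j +ℕ y +ℕ r +ℕ j
      shuffle = ℕSolver.solve-∀
    j+[y+r]≡K+j : j +ℕ (y +ℕ r) ≡ K +ℕ j
    j+[y+r]≡K+j = trans (ℕP.+-comm j (y +ℕ r)) (cong (_+ℕ j) (trans (ℕP.+-comm y r) r+y≡K))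
    regroup : ∀ s s′ t A B → (s * s′ * t) * (A * B) ≡ (s * A) * ((s′ * t) * B)
    regroup = solve-∀ ℚ-ring

  pairSum-short : ∀ m S j → S < j +ℕ j → pairSum m S j ≡ 0ℚ
  pairSum-short m S j S<2j = Σ<-zero (suc S) (λ t t≤S → pairTerm-vanish m S j t (small t (ℕP.≤-pred t≤S)))
    where
    small : ∀ t → t ≤ S → S ∸ t < j ⊎ t < j
    small t t≤S with t ℕP.<? j
    ... | yes t<j = inj₂ t<j
    ... | no t≮j = inj₁ (ℕP.+-cancelʳ-< t (S ∸ t) j
                     (subst (_< j +ℕ t) (sym (ℕP.m∸n+n≡m t≤S)) (ℕP.<-≤-trans S<2j (ℕP.+-monoʳ-≤ j (ℕP.≮⇒≥ t≮j)))))

  pairSum-rothe : ∀ m j K → pairSum m (K +ℕ (j +ℕ j)) j ≡ sign j * qbin q (K +ℕ j) j * rothe q (m ℤ.+ + j) K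
  pairSum-rothe m j K = begin
    Σ< (suc S) g                                     ≡⟨ cong (λ n → Σ< n g) (length K j) ⟩
    Σ< (j +ℕ suc (K +ℕ j)) g                         ≡⟨ Σ<-split j (suc (K +ℕ j)) g ⟩
    Σ< j g + Σ< (suc (K +ℕ j)) (λ r → g (j +ℕ r))
      ≡⟨ cong₂ _+_ (Σ<-zero j before) (Σ<-tail-zero (λ r → g (j +ℕ r)) (s≤s (ℕP.m≤m+n K j)) after) ⟩
    0ℚ + Σ< (suc K) (λ r → g (j +ℕ r))               ≡⟨ ℚP.+-identityˡ _ ⟩
    Σ< (suc K) (λ r → g (j +ℕ r))                    ≡⟨ Σ<-cong (suc K) (λ r r≤K → pairTerm-revision m j K r (ℕP.≤-pred r≤K)) ⟩
    Σ< (suc K) (λ r → c₀ * ((sign r * q ^ Tℕ (m ℤ.+ + j ℤ.+ + r)) * qbin q K r))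
                                                     ≡⟨ Σ<-*ˡ (suc K) c₀ _ ⟩
    c₀ * rothe q (m ℤ.+ + j) K                       ∎
    where
    open ≡-Reasoning
    S = K +ℕ (j +ℕ j)
    c₀ = sign j * qbin q (K +ℕ j) j
    g : ℕ → ℚ
    g = pairTerm m S j
    length : ∀ K j → suc (K +ℕ (j +ℕ j)) ≡ j +ℕ suc (K +ℕ j)
    length = ℕSolver.solve-∀
    before : ∀ t → t < j → g t ≡ 0ℚ
    before t t<j = pairTerm-vanish m S j t (inj₂ t<j)
    after : ∀ r → suc K ≤ r → r < suc (K +ℕ j) → g (j +ℕ r) ≡ 0ℚ
    after r K<r (s≤s r≤K+j) = pairTerm-vanish m S j (j +ℕ r) (inj₁ (subst (S ∸ (j +ℕ r) <_) (ℕP.m+n∸m≡n (j +ℕ r) j)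
      (ℕP.∸-monoˡ-< S<j+r+j (subst (j +ℕ r ≤_) (shuffle K j) (ℕP.+-monoʳ-≤ j r≤K+j)))))
      where
      shuffle : ∀ K j → j +ℕ (K +ℕ j) ≡ K +ℕ (j +ℕ j)
      shuffle = ℕSolver.solve-∀
      S<j+r+j : S < j +ℕ r +ℕ j
      S<j+r+j = subst₂ _<_ (ℕP.+-comm (j +ℕ j) K) (trans (ℕP.+-comm (j +ℕ j) r) (shuffle′ r j))
                       (ℕP.+-monoʳ-< (j +ℕ j) K<r)
        where
        shuffle′ : ∀ r j → r +ℕ (j +ℕ j) ≡ j +ℕ r +ℕ j
        shuffle′ = ℕSolver.solve-∀

qbinom≡qbin : ∀ q n k → (∀ t → 1 ≤ t → t ≤ n → 1ℚ - q ^ t ≢ 0ℚ) → qbinom q (+ n) (+ k) ≡ qbin q n k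
qbinom≡qbin q n k q^t≢1 with ℤ.0ℤ ℤ.≤? + k | + k ℤ.≤? + n
... | no 0≰k | _ = ⊥-elim (0≰k (ℤ.+≤+ z≤n))
... | yes _ | no k≰n = sym (qbin-vanish q n k (ℕP.≰⇒> (λ k≤n → k≰n (ℤ.+≤+ k≤n))))
... | yes _ | yes (ℤ.+≤+ k≤n) = begin
  poch q q n * inv (poch q q k * pochℤ q q (+ n ℤ.- + k))   ≡⟨ cong (λ t → poch q q n * inv (poch q q k * pochℤ q q t)) (+[m∸n]≡+m-+n k≤n) ⟨
  poch q q n * inv (poch q q k * poch q q (n ∸ k))          ≡⟨ x≡y*d⇒x*inv[d]≡y (*-≢0 (qpoch-≢0 k≤n) (qpoch-≢0 (ℕP.m∸n≤m n k))) factorial ⟩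
  qbin q n k                                                ∎
  where
  open ≡-Reasoning
  qpoch-≢0 : ∀ {m} → m ≤ n → poch q q m ≢ 0ℚ
  qpoch-≢0 m≤n = poch-≢0 q q _ (λ t t<m → q^t≢1 (suc t) (s≤s z≤n) (ℕP.≤-trans t<m m≤n))
  factorial : poch q q n ≡ qbin q n k * (poch q q k * poch q q (n ∸ k))
  factorial = begin
    poch q q n                                                 ≡⟨ cong (poch q q) (ℕP.m+[n∸m]≡n k≤n) ⟨
    poch q q (k +ℕ (n ∸ k))                                    ≡⟨ qbin*poch*poch q k (n ∸ k) ⟨
    qbin q (k +ℕ (n ∸ k)) k * (poch q q k * poch q q (n ∸ k))  ≡⟨ cong (λ t → qbin q t k * (poch q q k * poch q q (n ∸ k))) (ℕP.m+[n∸m]≡n k≤n) ⟩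
    qbin q n k * (poch q q k * poch q q (n ∸ k))               ∎

module _ (L : ℕ) (q z c : ℚ) where

  prefactor : ℕ → ℕ → ℚ
  prefactor i j = z ^ℤ (+ i ℤ.- + j) * q ^ tri j * cFactor q c j * qbin q (L ∸ i) j * q ^ tri i

  summand : ℕ → ℕ → ℚ
  summand i j = prefactor i j * poch (q ^ suc i) q (L ∸ i ∸ j)

  prefactor-vanish : ∀ i j → L ∸ i < j → prefactor i j ≡ 0ℚ
  prefactor-vanish i j L∸i<j = begin
    prefactor i j                  ≡⟨ cong (λ x → Z * x * q ^ tri i) (qbin-vanish q (L ∸ i) j L∸i<j) ⟩
    Z * 0ℚ * q ^ tri i             ≡⟨ cong (_* q ^ tri i) (ℚP.*-zeroʳ Z) ⟩
    0ℚ * q ^ tri i                 ≡⟨ ℚP.*-zeroˡ (q ^ tri i) ⟩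
    0ℚ                             ∎
    where
    open ≡-Reasoning
    Z = z ^ℤ (+ i ℤ.- + j) * q ^ tri j * cFactor q c j

  summand-vanish : ∀ i j → L ∸ i < j → summand i j ≡ 0ℚ
  summand-vanish i j L∸i<j = trans (cong (_* poch (q ^ suc i) q (L ∸ i ∸ j)) (prefactor-vanish i j L∸i<j))
                                   (ℚP.*-zeroˡ (poch (q ^ suc i) q (L ∸ i ∸ j)))

  rhsTerm : ℕ → ℕ → ℕ → ℚ
  rhsTerm i j k = ((- 1ℚ) ^ k) * (z ^ℤ (+ i ℤ.- + j)) * (q ^ℤ (T (+ i) ℤ.+ T (+ j) ℤ.+ T (+ k))) * ((1ℚ - c) * inv (1ℚ - c * (q ^ j)))
                  * qbinom q (+ L ℤ.- + i) (+ j) * qbinom q (+ L ℤ.- + j) (+ k) * qbinom q (+ L ℤ.- + k) (+ i)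

  module _ (q^t≢1 : ∀ t → 1 ≤ t → t ≤ L → 1ℚ - q ^ t ≢ 0ℚ) where

    qbinom[L-i]≡qbin : ∀ i k → i ≤ L → qbinom q (+ L ℤ.- + i) (+ k) ≡ qbin q (L ∸ i) k
    qbinom[L-i]≡qbin i k i≤L = trans (cong (λ n → qbinom q n (+ k)) (sym (+[m∸n]≡+m-+n i≤L)))
      (qbinom≡qbin q (L ∸ i) k (λ t 1≤t t≤L∸i → q^t≢1 t 1≤t (ℕP.≤-trans t≤L∸i (ℕP.m∸n≤m L i))))

    rhsTerm-factor : ∀ i j k → i ≤ L → j ≤ L → k ≤ L →
      rhsTerm i j k ≡ prefactor i j * ((sign k * q ^ tri k) * (qbin q (L ∸ j) k * qbin q (L ∸ k) i))
    rhsTerm-factor i j k i≤L j≤L k≤L = begin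
      rhsTerm i j k
        ≡⟨ cong (λ e → sign k * Z * (q ^ℤ e) * D * qbinom q (+ L ℤ.- + i) (+ j) * qbinom q (+ L ℤ.- + j) (+ k) * qbinom q (+ L ℤ.- + k) (+ i))
                (cong₂ ℤ._+_ (cong₂ ℤ._+_ (T≡Tℕ (+ i)) (T≡Tℕ (+ j))) (T≡Tℕ (+ k))) ⟩
      sign k * Z * q ^ (tri i +ℕ tri j +ℕ tri k) * D * qbinom q (+ L ℤ.- + i) (+ j) * qbinom q (+ L ℤ.- + j) (+ k) * qbinom q (+ L ℤ.- + k) (+ i)
        ≡⟨ cong (λ e → sign k * Z * e * D * qbinom q (+ L ℤ.- + i) (+ j) * qbinom q (+ L ℤ.- + j) (+ k) * qbinom q (+ L ℤ.- + k) (+ i))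
                (trans (^-distribˡ-+-* q (tri i +ℕ tri j) (tri k)) (cong (_* q ^ tri k) (^-distribˡ-+-* q (tri i) (tri j)))) ⟩
      sign k * Z * (q ^ tri i * q ^ tri j * q ^ tri k) * D * qbinom q (+ L ℤ.- + i) (+ j) * qbinom q (+ L ℤ.- + j) (+ k) * qbinom q (+ L ℤ.- + k) (+ i)
        ≡⟨ cong₂ (λ a b → sign k * Z * (q ^ tri i * q ^ tri j * q ^ tri k) * D * a * b * qbinom q (+ L ℤ.- + k) (+ i))
                 (qbinom[L-i]≡qbin i j i≤L) (qbinom[L-i]≡qbin j k j≤L) ⟩
      sign k * Z * (q ^ tri i * q ^ tri j * q ^ tri k) * D * qbin q (L ∸ i) j * qbin q (L ∸ j) k * qbinom q (+ L ℤ.- + k) (+ i)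
        ≡⟨ cong (λ b → sign k * Z * (q ^ tri i * q ^ tri j * q ^ tri k) * D * qbin q (L ∸ i) j * qbin q (L ∸ j) k * b)
                (qbinom[L-i]≡qbin k i k≤L) ⟩
      sign k * Z * (q ^ tri i * q ^ tri j * q ^ tri k) * D * qbin q (L ∸ i) j * qbin q (L ∸ j) k * qbin q (L ∸ k) i
        ≡⟨ regroup (sign k) Z (q ^ tri i) (q ^ tri j) (q ^ tri k) D (qbin q (L ∸ i) j) (qbin q (L ∸ j) k) (qbin q (L ∸ k) i) ⟩
      prefactor i j * ((sign k * q ^ tri k) * (qbin q (L ∸ j) k * qbin q (L ∸ k) i)) ∎
      where
      open ≡-Reasoning
      Z = z ^ℤ (+ i ℤ.- + j)
      D = cFactor q c j
      regroup : ∀ s Z ti tj tk D B₁ B₂ B₃ → s * Z * (ti * tj * tk) * D * B₁ * B₂ * B₃ ≡ (Z * tj * D * B₁ * ti) * ((s * tk) * (B₂ * B₃))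
      regroup = solve-∀ ℚ-ring

    rhs-inner : ∀ i j → i ≤ L → j ≤ L → Σ< (suc L) (rhsTerm i j) ≡ summand i j
    rhs-inner i j i≤L j≤L = begin
      Σ< (suc L) (rhsTerm i j)
        ≡⟨ Σ<-cong (suc L) (λ k k≤L → rhsTerm-factor i j k i≤L j≤L (ℕP.≤-pred k≤L)) ⟩
      Σ< (suc L) (λ k → prefactor i j * ((sign k * q ^ tri k) * (qbin q (L ∸ j) k * qbin q (L ∸ k) i)))
        ≡⟨ Σ<-*ˡ (suc L) (prefactor i j) _ ⟩
      prefactor i j * altSum q tri (L ∸ j) L i
        ≡⟨ evaluate (i ℕP.≤? L ∸ j) ⟩
      summand i j ∎
      where
      open ≡-Reasoning
      evaluate : Dec (i ≤ L ∸ j) → prefactor i j * altSum q tri (L ∸ j) L i ≡ summand i j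
      evaluate (yes i≤L∸j) = cong (prefactor i j *_) (begin
        altSum q tri (L ∸ j) L i              ≡⟨ cong (λ n → altSum q tri n L i) (ℕP.m+[n∸m]≡n i≤L∸j) ⟨
        altSum q tri (i +ℕ (L ∸ j ∸ i)) L i
          ≡⟨ altSum-tri-eval q i (L ∸ j ∸ i) L (subst (_≤ L) (sym (ℕP.m+[n∸m]≡n i≤L∸j)) (ℕP.m∸n≤m L j)) ⟩
        poch (q ^ suc i) q (L ∸ j ∸ i)        ≡⟨ cong (poch (q ^ suc i) q) (∸-comm L j i) ⟩
        poch (q ^ suc i) q (L ∸ i ∸ j)        ∎)
      evaluate (no i≰L∸j) = trans (cong (_* altSum q tri (L ∸ j) L i) (prefactor-vanish i j L∸i<j))
                                  (trans (ℚP.*-zeroˡ (altSum q tri (L ∸ j) L i)) (sym (summand-vanish i j L∸i<j)))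
        where
        L∸i<j : L ∸ i < j
        L∸i<j = m∸n<o⇒m∸o<n i≤L (ℕP.≰⇒> i≰L∸j)

    rhs≡Σsummand : rhs L q z c ≡ Σ< (suc L) (λ j → Σ< (suc L) (λ i → summand i j))
    rhs≡Σsummand = begin
      rhs L q z c
        ≡⟨ Σℕ≡Σ< L _ ⟩
      Σ< (suc L) (λ i → Σℕ[0⋯ L ] (λ j → Σℕ[0⋯ L ] (rhsTerm i j)))
        ≡⟨ Σ<-cong (suc L) (λ i _ → trans (Σℕ≡Σ< L _) (Σ<-cong (suc L) (λ j _ → Σℕ≡Σ< L (rhsTerm i j)))) ⟩
      Σ< (suc L) (λ i → Σ< (suc L) (λ j → Σ< (suc L) (rhsTerm i j)))
        ≡⟨ Σ<-cong (suc L) (λ i i≤L → Σ<-cong (suc L) (λ j j≤L → rhs-inner i j (ℕP.≤-pred i≤L) (ℕP.≤-pred j≤L))) ⟩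
      Σ< (suc L) (λ i → Σ< (suc L) (λ j → summand i j))
        ≡⟨ Σ<-swap (suc L) (suc L) summand ⟩
      Σ< (suc L) (λ j → Σ< (suc L) (λ i → summand i j))
        ∎
      where open ≡-Reasoning

  twoL : ℕ
  twoL = L +ℕ L

  ι : ℕ → ℤ
  ι v = ℤ.- (+ L) ℤ.+ + v

  lhsTerm : ℤ → ℤ → ℚ
  lhsTerm n m = ((- 1ℚ) ^ℤ (n ℤ.+ m)) * (z ^ℤ m) * (q ^ℤ T n)
    * pochℤ (c * q) q (+ L ℤ.- m)
    * inv (pochℤ (c * q) q (+ L ℤ.- n) * pochℤ (c * q) q (n ℤ.- m))

  L-ι : ∀ v → v ≤ twoL → + L ℤ.- ι v ≡ + (twoL ∸ v)
  L-ι v v≤2L = trans (reflect (+ L) (+ v)) (sym (+[m∸n]≡+m-+n v≤2L))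
    where
    reflect : ∀ a b → a ℤ.- (ℤ.- a ℤ.+ b) ≡ (a ℤ.+ a) ℤ.- b
    reflect = ℤSolver.solve-∀

  lhs≡Σ<Σ< : lhs L q z c ≡ Σ< (suc twoL) (λ v → Σ< (suc (twoL ∸ v)) (λ t → lhsTerm (ι (v +ℕ t)) (ι v)))
  lhs≡Σ<Σ< = begin
    Σ[ ℤ.- (+ L) ⋯ + L ] (λ n → Σ[ ℤ.- (+ L) ⋯ n ] (lhsTerm n))
      ≡⟨ cong (λ b → Σ[ ℤ.- (+ L) ⋯ b ] (λ n → Σ[ ℤ.- (+ L) ⋯ n ] (lhsTerm n))) (top (+ L)) ⟩
    Σ[ ℤ.- (+ L) ⋯ ι twoL ] (λ n → Σ[ ℤ.- (+ L) ⋯ n ] (lhsTerm n))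
      ≡⟨ Σ[⋯]≡Σ< (ℤ.- (+ L)) twoL _ ⟩
    Σ< (suc twoL) (λ u → Σ[ ℤ.- (+ L) ⋯ ι u ] (lhsTerm (ι u)))
      ≡⟨ Σ<-cong (suc twoL) (λ u _ → Σ[⋯]≡Σ< (ℤ.- (+ L)) u (lhsTerm (ι u))) ⟩
    Σ< (suc twoL) (λ u → Σ< (suc u) (λ v → lhsTerm (ι u) (ι v)))
      ≡⟨ Σ<-triangle twoL (λ u v → lhsTerm (ι u) (ι v)) ⟩
    Σ< (suc twoL) (λ v → Σ< (suc (twoL ∸ v)) (λ t → lhsTerm (ι (v +ℕ t)) (ι v)))
      ∎
    where
    open ≡-Reasoning
    top : ∀ a → a ≡ ℤ.- a ℤ.+ (a ℤ.+ a)
    top = ℤSolver.solve-∀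

  columnTerm : ℕ → ℕ → ℚ
  columnTerm j v = z ^ℤ ι v * (weight q c j * pairSum q (ι v) (twoL ∸ v) j)

  column : ℕ → ℚ
  column j = Σ< (suc twoL) (columnTerm j)

  columnTerm-short : ∀ j v → twoL ∸ v < j +ℕ j → columnTerm j v ≡ 0ℚ
  columnTerm-short j v short = trans (cong (λ x → z ^ℤ ι v * (weight q c j * x)) (pairSum-short q (ι v) (twoL ∸ v) j short))
                                     (x*[y*0]≡0 (z ^ℤ ι v) (weight q c j))

  columnTerm-rothe : ∀ j v K → v +ℕ (K +ℕ (j +ℕ j)) ≡ twoL →
    columnTerm j v ≡ z ^ℤ ι v * (weight q c j * (sign j * qbin q (K +ℕ j) j * rothe q (ι v ℤ.+ + j) K))
  columnTerm-rothe j v K v+K+2j≡2L = cong (λ x → z ^ℤ ι v * (weight q c j * x))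
    (trans (cong (λ S → pairSum q (ι v) S j) (trans (cong (_∸ v) (sym v+K+2j≡2L)) (ℕP.m+n∸m≡n v (K +ℕ (j +ℕ j)))))
           (pairSum-rothe q (ι v) j K))

  columnTerm-negative : ∀ j v → v +ℕ j < L → columnTerm j v ≡ 0ℚ
  columnTerm-negative j v v+j<L = begin
    columnTerm j v
      ≡⟨ columnTerm-rothe j v K total ⟩
    z ^ℤ ι v * (weight q c j * (sign j * qbin q (K +ℕ j) j * rothe q (ι v ℤ.+ + j) K))
      ≡⟨ cong (λ x → z ^ℤ ι v * (weight q c j * (sign j * qbin q (K +ℕ j) j * rothe q x K))) ι[v]+j≡-[1+s] ⟩
    z ^ℤ ι v * (weight q c j * (sign j * qbin q (K +ℕ j) j * rothe q -[1+ s ] K))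
      ≡⟨ cong (λ x → z ^ℤ ι v * (weight q c j * (sign j * qbin q (K +ℕ j) j * x))) (rothe-neg q s K s<K) ⟩
    z ^ℤ ι v * (weight q c j * (sign j * qbin q (K +ℕ j) j * 0ℚ))
      ≡⟨ cong (λ x → z ^ℤ ι v * x) (x*[y*0]≡0 (weight q c j) (sign j * qbin q (K +ℕ j) j)) ⟩
    z ^ℤ ι v * 0ℚ
      ≡⟨ ℚP.*-zeroʳ (z ^ℤ ι v) ⟩
    0ℚ ∎
    where
    open ≡-Reasoning
    s = L ∸ suc (v +ℕ j)
    K = v +ℕ suc (suc (s +ℕ s))
    L≡1+v+j+s : suc (v +ℕ j) +ℕ s ≡ L
    L≡1+v+j+s = ℕP.m+[n∸m]≡n v+j<L
    total : v +ℕ (K +ℕ (j +ℕ j)) ≡ twoL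
    total = trans (shuffle v j s) (cong₂ _+ℕ_ L≡1+v+j+s L≡1+v+j+s)
      where
      shuffle : ∀ v j s → v +ℕ (v +ℕ suc (suc (s +ℕ s)) +ℕ (j +ℕ j)) ≡ (suc (v +ℕ j) +ℕ s) +ℕ (suc (v +ℕ j) +ℕ s)
      shuffle = ℕSolver.solve-∀
    ι[v]+j≡-[1+s] : ι v ℤ.+ + j ≡ -[1+ s ]
    ι[v]+j≡-[1+s] = trans (cong (λ l → ℤ.- (+ l) ℤ.+ + v ℤ.+ + j) (sym L≡1+v+j+s)) (cancel (+ v) (+ j) (+ s))
      where
      cancel : ∀ v j s → ℤ.- (+ 1 ℤ.+ v ℤ.+ j ℤ.+ s) ℤ.+ v ℤ.+ j ≡ ℤ.- (+ 1 ℤ.+ s)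
      cancel = ℤSolver.solve-∀
    s<K : s < K
    s<K = ℕP.≤-trans (s≤s (ℕP.≤-trans (ℕP.m≤m+n s s) (ℕP.n≤1+n (s +ℕ s)))) (ℕP.m≤n+m (suc (suc (s +ℕ s))) v)

  columnTerm-summand : ∀ i j → j ≤ L → i ≤ L ∸ j → columnTerm j (L ∸ j +ℕ i) ≡ summand i j
  columnTerm-summand i j j≤L i≤L∸j = begin
    columnTerm j v
      ≡⟨ columnTerm-rothe j v K total ⟩
    z ^ℤ ι v * (weight q c j * (sign j * qbin q (K +ℕ j) j * rothe q (ι v ℤ.+ + j) K))
      ≡⟨ cong₂ (λ n x → z ^ℤ ι v * (weight q c j * (sign j * qbin q n j * rothe q x K))) K+j≡L∸i ι[v]+j≡i ⟩
    z ^ℤ ι v * (weight q c j * (sign j * qbin q (L ∸ i) j * rothe q (+ i) K))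
      ≡⟨ cong (λ x → z ^ℤ ι v * (weight q c j * (sign j * qbin q (L ∸ i) j * x))) (rothe-nonneg q i K) ⟩
    z ^ℤ ι v * (weight q c j * (sign j * qbin q (L ∸ i) j * (q ^ tri i * poch (q ^ suc i) q K)))
      ≡⟨ cong₂ (λ x n → z ^ℤ x * (weight q c j * (sign j * qbin q (L ∸ i) j * (q ^ tri i * poch (q ^ suc i) q n)))) ι[v]≡i-j K≡L∸i∸j ⟩
    z ^ℤ (+ i ℤ.- + j) * (weight q c j * (sign j * qbin q (L ∸ i) j * (q ^ tri i * poch (q ^ suc i) q (L ∸ i ∸ j))))
      ≡⟨ sign²-cancel (z ^ℤ (+ i ℤ.- + j)) (sign j) (q ^ tri j) (cFactor q c j) (qbin q (L ∸ i) j)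
                      (q ^ tri i) (poch (q ^ suc i) q (L ∸ i ∸ j)) (sign*sign≡1 j) ⟩
    summand i j ∎
    where
    open ≡-Reasoning
    A = L ∸ j
    v = A +ℕ i
    K = A ∸ i
    A+j≡L : A +ℕ j ≡ L
    A+j≡L = ℕP.m∸n+n≡m j≤L
    K+i≡A : K +ℕ i ≡ A
    K+i≡A = ℕP.m∸n+n≡m i≤L∸j
    total : v +ℕ (K +ℕ (j +ℕ j)) ≡ twoL
    total = trans (shuffle A i K j) (cong₂ _+ℕ_ A+j≡L (trans (cong (_+ℕ j) K+i≡A) A+j≡L))
      where
      shuffle : ∀ A i K j → A +ℕ i +ℕ (K +ℕ (j +ℕ j)) ≡ (A +ℕ j) +ℕ ((K +ℕ i) +ℕ j)
      shuffle = ℕSolver.solve-∀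
    K+j≡L∸i : K +ℕ j ≡ L ∸ i
    K+j≡L∸i = trans (sym (ℕP.+-∸-comm j i≤L∸j)) (cong (_∸ i) A+j≡L)
    K≡L∸i∸j : K ≡ L ∸ i ∸ j
    K≡L∸i∸j = ∸-comm L j i
    ι[v]≡i-j : ι v ≡ + i ℤ.- + j
    ι[v]≡i-j = trans (cong (λ l → ℤ.- (+ l) ℤ.+ + v) (sym A+j≡L)) (cancel (+ A) (+ j) (+ i))
      where
      cancel : ∀ A j i → ℤ.- (A ℤ.+ j) ℤ.+ (A ℤ.+ i) ≡ i ℤ.- j
      cancel = ℤSolver.solve-∀
    ι[v]+j≡i : ι v ℤ.+ + j ≡ + i
    ι[v]+j≡i = trans (cong (ℤ._+ + j) ι[v]≡i-j) (cancel (+ i) (+ j))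
      where
      cancel : ∀ i j → i ℤ.- j ℤ.+ j ≡ i
      cancel = ℤSolver.solve-∀

  column-high : ∀ j → L < j → column j ≡ 0ℚ
  column-high j L<j = Σ<-zero (suc twoL)
    (λ v _ → columnTerm-short j v (ℕP.≤-<-trans (ℕP.m∸n≤m twoL v) (ℕP.+-mono-< L<j L<j)))

  column-eval : ∀ j → j ≤ L → column j ≡ Σ< (suc L) (λ i → summand i j)
  column-eval j j≤L = begin
    Σ< (suc twoL) (columnTerm j)
      ≡⟨ cong (λ n → Σ< n (columnTerm j)) length ⟩
    Σ< (A +ℕ suc (L +ℕ j)) (columnTerm j)
      ≡⟨ Σ<-split A (suc (L +ℕ j)) (columnTerm j) ⟩
    Σ< A (columnTerm j) + Σ< (suc (L +ℕ j)) (λ i → columnTerm j (A +ℕ i))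
      ≡⟨ cong₂ _+_ (Σ<-zero A (λ v v<A → columnTerm-negative j v (subst (v +ℕ j <_) A+j≡L (ℕP.+-monoˡ-< j v<A))))
                   (Σ<-tail-zero (λ i → columnTerm j (A +ℕ i)) (s≤s A≤L+j) above) ⟩
    0ℚ + Σ< (suc A) (λ i → columnTerm j (A +ℕ i))
      ≡⟨ ℚP.+-identityˡ _ ⟩
    Σ< (suc A) (λ i → columnTerm j (A +ℕ i))
      ≡⟨ Σ<-cong (suc A) (λ i i≤A → columnTerm-summand i j j≤L (ℕP.≤-pred i≤A)) ⟩
    Σ< (suc A) (λ i → summand i j)
      ≡⟨ Σ<-tail-zero (λ i → summand i j) (s≤s (ℕP.m∸n≤m L j)) beyond ⟨
    Σ< (suc L) (λ i → summand i j) ∎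
    where
    open ≡-Reasoning
    A = L ∸ j
    A+j≡L : A +ℕ j ≡ L
    A+j≡L = ℕP.m∸n+n≡m j≤L
    length : suc twoL ≡ A +ℕ suc (L +ℕ j)
    length = trans (cong (λ l → suc (l +ℕ L)) (sym A+j≡L)) (shuffle A j L)
      where
      shuffle : ∀ A j L → suc (A +ℕ j +ℕ L) ≡ A +ℕ suc (L +ℕ j)
      shuffle = ℕSolver.solve-∀
    A≤L+j : A ≤ L +ℕ j
    A≤L+j = ℕP.≤-trans (ℕP.m∸n≤m L j) (ℕP.m≤m+n L j)
    above : ∀ i → suc A ≤ i → i < suc (L +ℕ j) → columnTerm j (A +ℕ i) ≡ 0ℚ
    above i A<i (s≤s i≤L+j) = columnTerm-short j (A +ℕ i)
      (ℕP.+-cancelʳ-< (A +ℕ i) (twoL ∸ (A +ℕ i)) (j +ℕ j) (subst₂ _<_ (sym (ℕP.m∸n+n≡m v≤2L)) (ℕP.+-comm (A +ℕ i) (j +ℕ j)) 2L<v+2j))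
      where
      v≤2L : A +ℕ i ≤ twoL
      v≤2L = subst (A +ℕ i ≤_) (trans (shuffle A L j) (cong (_+ℕ L) A+j≡L)) (ℕP.+-monoʳ-≤ A i≤L+j)
        where
        shuffle : ∀ A L j → A +ℕ (L +ℕ j) ≡ A +ℕ j +ℕ L
        shuffle = ℕSolver.solve-∀
      2L<v+2j : twoL < A +ℕ i +ℕ (j +ℕ j)
      2L<v+2j = subst (_< A +ℕ i +ℕ (j +ℕ j)) (trans (shuffle A j) (cong₂ _+ℕ_ A+j≡L A+j≡L))
                      (ℕP.+-monoˡ-< (j +ℕ j) (ℕP.+-monoʳ-< A A<i))
        where
        shuffle : ∀ A j → A +ℕ A +ℕ (j +ℕ j) ≡ (A +ℕ j) +ℕ (A +ℕ j)
        shuffle = ℕSolver.solve-∀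
    beyond : ∀ i → suc A ≤ i → i < suc L → summand i j ≡ 0ℚ
    beyond i A<i (s≤s i≤L) = summand-vanish i j (m∸n<o⇒m∸o<n i≤L A<i)

  ratioSum-extend : ∀ a t → a ≤ twoL → ratioSum q c a t ≡ Σ< (suc twoL) (λ j → weight q c j * binomialPair q a t j)
  ratioSum-extend a t a≤2L = sym (Σ<-tail-zero (λ j → weight q c j * binomialPair q a t j) (s≤s a≤2L)
    (λ j a<j _ → trans (cong (weight q c j *_) (binomialPair-vanish q a t j (inj₁ a<j))) (ℚP.*-zeroʳ (weight q c j))))

  module _ (cq^t≢1 : ∀ t → t ≤ twoL → 1ℚ - c * q ^ t ≢ 0ℚ) where

    lhsTerm-expand : ∀ v t → v +ℕ t ≤ twoL →
      lhsTerm (ι (v +ℕ t)) (ι v) ≡ z ^ℤ ι v * ((sign t * q ^ Tℕ (ι v ℤ.+ + t)) * ratioSum q c (twoL ∸ v ∸ t) t)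
    lhsTerm-expand v t v+t≤2L = begin
      s * z ^ℤ ι v * e * P * I                       ≡⟨ cong₂ (λ x y → x * z ^ℤ ι v * y * P * I) sign-part power-part ⟩
      sign t * z ^ℤ ι v * q ^ Tℕ (ι v ℤ.+ + t) * P * I ≡⟨ ℚP.*-assoc (sign t * z ^ℤ ι v * q ^ Tℕ (ι v ℤ.+ + t)) P I ⟩
      sign t * z ^ℤ ι v * q ^ Tℕ (ι v ℤ.+ + t) * (P * I) ≡⟨ cong (sign t * z ^ℤ ι v * q ^ Tℕ (ι v ℤ.+ + t) *_) poch-part ⟩
      sign t * z ^ℤ ι v * q ^ Tℕ (ι v ℤ.+ + t) * ratioSum q c a t ≡⟨ regroup (sign t) (z ^ℤ ι v) (q ^ Tℕ (ι v ℤ.+ + t)) (ratioSum q c a t) ⟩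
      z ^ℤ ι v * ((sign t * q ^ Tℕ (ι v ℤ.+ + t)) * ratioSum q c a t) ∎
      where
      open ≡-Reasoning
      a = twoL ∸ v ∸ t
      s = (- 1ℚ) ^ℤ (ι (v +ℕ t) ℤ.+ ι v)
      e = q ^ℤ T (ι (v +ℕ t))
      P = pochℤ (c * q) q (+ L ℤ.- ι v)
      I = inv (pochℤ (c * q) q (+ L ℤ.- ι (v +ℕ t)) * pochℤ (c * q) q (ι (v +ℕ t) ℤ.- ι v))
      ι[v+t]≡ι[v]+t : ι (v +ℕ t) ≡ ι v ℤ.+ + t
      ι[v+t]≡ι[v]+t = sym (ℤP.+-assoc (ℤ.- (+ L)) (+ v) (+ t))
      sign-part : s ≡ sign t
      sign-part = trans (cong ((- 1ℚ) ^ℤ_) (pair (+ L) (+ v) (+ t))) (signℤ-even (+ t) (ι v))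
        where
        pair : ∀ L v t → ℤ.- L ℤ.+ (v ℤ.+ t) ℤ.+ (ℤ.- L ℤ.+ v) ≡ t ℤ.+ ((ℤ.- L ℤ.+ v) ℤ.+ (ℤ.- L ℤ.+ v))
        pair = ℤSolver.solve-∀
      power-part : e ≡ q ^ Tℕ (ι v ℤ.+ + t)
      power-part = trans (cong (q ^ℤ_) (T≡Tℕ (ι (v +ℕ t)))) (cong (λ n → q ^ Tℕ n) ι[v+t]≡ι[v]+t)
      t≤2L∸v : t ≤ twoL ∸ v
      t≤2L∸v = ℕP.m+n≤o⇒m≤o∸n t (subst (_≤ twoL) (ℕP.+-comm v t) v+t≤2L)
      2L∸v≡a+t : twoL ∸ v ≡ a +ℕ t
      2L∸v≡a+t = sym (ℕP.m∸n+n≡m t≤2L∸v)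
      poch-part : P * I ≡ ratioSum q c a t
      poch-part = begin
        P * I
          ≡⟨ cong₂ (λ x y → pochℤ (c * q) q x * inv (pochℤ (c * q) q y * pochℤ (c * q) q (ι (v +ℕ t) ℤ.- ι v)))
                   (L-ι v (ℕP.≤-trans (ℕP.m≤m+n v t) v+t≤2L))
                   (trans (L-ι (v +ℕ t) v+t≤2L) (cong +_ (sym (ℕP.∸-+-assoc twoL v t)))) ⟩
        cPoch q c (twoL ∸ v) * inv (cPoch q c a * pochℤ (c * q) q (ι (v +ℕ t) ℤ.- ι v))
          ≡⟨ cong₂ (λ n y → cPoch q c n * inv (cPoch q c a * pochℤ (c * q) q y)) 2L∸v≡a+t (difference (+ L) (+ v) (+ t)) ⟩
        cPoch q c (a +ℕ t) * inv (cPoch q c a * cPoch q c t)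
          ≡⟨ cPoch-ratio q c a t (λ j j≤a+t → cq^t≢1 j (ℕP.≤-trans j≤a+t (subst (_≤ twoL) 2L∸v≡a+t (ℕP.m∸n≤m twoL v)))) ⟩
        ratioSum q c a t ∎
        where
        difference : ∀ L v t → ℤ.- L ℤ.+ (v ℤ.+ t) ℤ.- (ℤ.- L ℤ.+ v) ≡ t
        difference = ℤSolver.solve-∀
      regroup : ∀ s Z Q R → s * Z * Q * R ≡ Z * ((s * Q) * R)
      regroup = solve-∀ ℚ-ring

    lhs≡Σcolumn : lhs L q z c ≡ Σ< (suc twoL) column
    lhs≡Σcolumn = begin
      lhs L q z c
        ≡⟨ lhs≡Σ<Σ< ⟩
      Σ< (suc twoL) (λ v → Σ< (suc (twoL ∸ v)) (λ t → lhsTerm (ι (v +ℕ t)) (ι v)))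
        ≡⟨ Σ<-cong (suc twoL) (λ v v≤2L → Σ<-cong (suc (twoL ∸ v)) (λ t t≤2L∸v → expand v t (ℕP.≤-pred v≤2L) (ℕP.≤-pred t≤2L∸v))) ⟩
      Σ< (suc twoL) (λ v → Σ< (suc (twoL ∸ v)) (λ t → z ^ℤ ι v * ((sign t * q ^ Tℕ (ι v ℤ.+ + t))
                                                    * Σ< (suc twoL) (λ j → weight q c j * binomialPair q (twoL ∸ v ∸ t) t j))))
        ≡⟨ Σ<-cong (suc twoL) (λ v _ → Σ<-swap-weighted (suc (twoL ∸ v)) (suc twoL) (z ^ℤ ι v) (λ t → sign t * q ^ Tℕ (ι v ℤ.+ + t))
                                                         (weight q c) (λ t j → binomialPair q (twoL ∸ v ∸ t) t j)) ⟩
      Σ< (suc twoL) (λ v → Σ< (suc twoL) (λ j → z ^ℤ ι v * (weight q c j * pairSum q (ι v) (twoL ∸ v) j)))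
        ≡⟨ Σ<-swap (suc twoL) (suc twoL) (λ v j → z ^ℤ ι v * (weight q c j * pairSum q (ι v) (twoL ∸ v) j)) ⟩
      Σ< (suc twoL) column
        ∎
      where
      open ≡-Reasoning
      expand : ∀ v t → v ≤ twoL → t ≤ twoL ∸ v → lhsTerm (ι (v +ℕ t)) (ι v)
               ≡ z ^ℤ ι v * ((sign t * q ^ Tℕ (ι v ℤ.+ + t)) * Σ< (suc twoL) (λ j → weight q c j * binomialPair q (twoL ∸ v ∸ t) t j))
      expand v t v≤2L t≤2L∸v = trans (lhsTerm-expand v t v+t≤2L)
        (cong (λ x → z ^ℤ ι v * ((sign t * q ^ Tℕ (ι v ℤ.+ + t)) * x))
              (ratioSum-extend (twoL ∸ v ∸ t) t (ℕP.≤-trans (ℕP.m∸n≤m (twoL ∸ v) t) (ℕP.m∸n≤m twoL v))))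
        where
        v+t≤2L : v +ℕ t ≤ twoL
        v+t≤2L = subst (v +ℕ t ≤_) (ℕP.m+[n∸m]≡n v≤2L) (ℕP.+-monoʳ-≤ v t≤2L∸v)

    lhs≡Σsummand : lhs L q z c ≡ Σ< (suc L) (λ j → Σ< (suc L) (λ i → summand i j))
    lhs≡Σsummand = begin
      lhs L q z c                                        ≡⟨ lhs≡Σcolumn ⟩
      Σ< (suc twoL) column                               ≡⟨ Σ<-tail-zero column (s≤s (ℕP.m≤m+n L L)) (λ j L<j _ → column-high j L<j) ⟩
      Σ< (suc L) column                                  ≡⟨ Σ<-cong (suc L) (λ j j≤L → column-eval j (ℕP.≤-pred j≤L)) ⟩
      Σ< (suc L) (λ j → Σ< (suc L) (λ i → summand i j))  ∎
      where open ≡-Reasoning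

mainTheorem1 : (L : ℕ) (q z c : ℚ)
    → z ≢ 0ℚ
    → (∀ k → 1 ≤ k → k ≤ L → 1ℚ - (q ^ k) ≢ 0ℚ)
    → (∀ k → k ≤ 2 Data.Nat.* L → 1ℚ - c * (q ^ k) ≢ 0ℚ)
    → lhs L q z c ≡ rhs L q z c
mainTheorem1 L q z c _ q^k≢1 cq^k≢1 =
  trans (lhs≡Σsummand L q z c (λ k k≤2L → cq^k≢1 k (subst (k ≤_) (cong (L +ℕ_) (sym (ℕP.+-identityʳ L))) k≤2L)))
        (sym (rhs≡Σsummand L q z c q^k≢1))
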